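{- Let $p,q,m$ be positive integers with $p\ge 2$, let $n=p+q+m$, and let $i$ be an integer with $1<i\le p$. The matrix $A=(C_p\oplus C_q\oplus C_m)+T(1,p+q,i,p+q+m)$ has finite multiplicative order if and only if $\gcd(p,q)$ and $\gcd(p,m)$ both divide $i-1$. In this case the order of $A$ is $\mathrm{lcm}(p,q,m)$ and $A$ is similar to the permutation matrix $C_p\oplus C_q\oplus C_m$.
   Context: $C_k$ is the $k\times k$ permutation matrix with $1$ in positions $(i+1,i)$ for $1\le i\le k-1$ and in position $(1,k)$ (companion matrix of $x^k-1$; $C_1=(1)$); $\oplus$ denotes matrix direct sum. $T(i_1,j_1,i_2,j_2)$ (with $i_1\ne i_2$, $j_1\ne j_2$) is the $n\times n$ matrix with $1$ in positions $(i_1,j_1),(i_2,j_2)$, $-1$ in positions $(i_1,j_2),(i_2,j_1)$, $0$ elsewhere. -}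

module Defs where

open import Data.Nat as ℕ using (ℕ; zero; suc; _≤_)
open import Data.Integer as ℤ using (ℤ; 0ℤ; 1ℤ; _+_; _*_; _-_)
open import Data.Fin using (Fin; zero; suc; toℕ; splitAt)
open import Data.Sum using (inj₁; inj₂)
open import Data.Product using (Σ; _×_; ∃)
open import Relation.Binary.PropositionalEquality using (_≡_)
open import Relation.Nullary.Decidable using (⌊_⌋)
open import Data.Bool using (Bool; true; false; _∧_; _∨_)

-- n × n integer matrices, entries indexed by Fin n (0-based: the paper's
-- position k corresponds to the Fin index with toℕ = k - 1).
Mat : ℕ → Set
Mat n = Fin n → Fin n → ℤ

_≈M_ : ∀ {n} → Mat n → Mat n → Set
A ≈M B = ∀ a b → A a b ≡ B a b

sumFin : ∀ {n} → (Fin n → ℤ) → ℤ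
sumFin {zero}  f = 0ℤ
sumFin {suc n} f = f zero + sumFin (λ c → f (suc c))

_*M_ : ∀ {n} → Mat n → Mat n → Mat n
(A *M B) a b = sumFin (λ c → A a c * B c b)

bool→ℤ : Bool → ℤ
bool→ℤ true  = 1ℤ
bool→ℤ false = 0ℤ

idM : ∀ {n} → Mat n
idM a b = bool→ℤ ⌊ toℕ a ℕ.≟ toℕ b ⌋

_^M_ : ∀ {n} → Mat n → ℕ → Mat n
A ^M zero  = idM
A ^M suc k = A *M (A ^M k)

_+M_ : ∀ {n} → Mat n → Mat n → Mat n
(A +M B) a b = A a b + B a b

-- C_k: 1 in (1-based) positions (r+1, r) for 1 ≤ r ≤ k-1 and (1, k).
-- 0-based: entry (a,b) is 1 iff a = b + 1, or a = 0 and b = k - 1.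
C : (k : ℕ) → Mat k
C k a b = bool→ℤ (⌊ toℕ a ℕ.≟ suc (toℕ b) ⌋ ∨ (⌊ toℕ a ℕ.≟ 0 ⌋ ∧ ⌊ suc (toℕ b) ℕ.≟ k ⌋))

_⊕_ : ∀ {k l} → Mat k → Mat l → Mat (k ℕ.+ l)
_⊕_ {k} {l} A B a b with splitAt k a | splitAt k b
... | inj₁ a' | inj₁ b' = A a' b'
... | inj₂ a' | inj₂ b' = B a' b'
... | inj₁ _  | inj₂ _  = 0ℤ
... | inj₂ _  | inj₁ _  = 0ℤ

at : ∀ {n} → ℕ → Fin n → ℤ
at r a = bool→ℤ ⌊ suc (toℕ a) ℕ.≟ r ⌋

-- T(i₁,j₁,i₂,j₂) with 1-based positions: 1 at (i₁,j₁),(i₂,j₂), -1 at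
-- (i₁,j₂),(i₂,j₁), 0 elsewhere (valid reading when i₁ ≠ i₂ and j₁ ≠ j₂).
T : ∀ {n} → ℕ → ℕ → ℕ → ℕ → Mat n
T i₁ j₁ i₂ j₂ a b =
  (at i₁ a * at j₁ b + at i₂ a * at j₂ b) - (at i₁ a * at j₂ b + at i₂ a * at j₁ b)

HasFiniteOrder : ∀ {n} → Mat n → Set
HasFiniteOrder A = Σ ℕ (λ k → 1 ≤ k × (A ^M k) ≈M idM)

IsOrderOf : ∀ {n} → Mat n → ℕ → Set
IsOrderOf A k = 1 ≤ k × (A ^M k) ≈M idM × (∀ j → 1 ≤ j → (A ^M j) ≈M idM → k ≤ j)

Similar : ∀ {n} → Mat n → Mat n → Set
Similar {n} A B = Σ (Mat n) (λ S → Σ (Mat n) (λ S' →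
  (S *M S') ≈M idM × (S' *M S) ≈M idM × (S *M A) ≈M (B *M S)))

{-# OPTIONS --safe #-}
-- Let P = C_p ⊕ C_q ⊕ C_m, the permutation matrix of the cyclic shift σ of each block, so that
-- A = P + u vᵀ with u = e_1 − e_i and v = e_{p+q} − e_n.
--
-- If gcd(p,q) and gcd(p,m) divide i − 1, choose r, r′ with r q ≡ r′ m ≡ i − 1 (mod p). A matrix N
-- supported on the rows of the first block and the columns of the other two, counting how often the
-- progressions j + k q (k < r) and j + k m (k < r′) hit each residue mod p, has N² = 0 and
-- (I + N) A = P (I + N). So A is similar to P, whose order is lcm(p,q,m).
--
-- Conversely, let g = gcd(p,q) and let w_k be the 0/1 row vector on the first two blocks marking the
-- positions c with g ∣ c + k. Since g divides p and q, w_k P = w_{k+1}, hence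
-- w_k A = w_{k+1} + (w_k(1) − w_k(i)) vᵀ. The rows of A below the first block are rows of P, so in
-- column p + q only powers t with q ∣ t contribute; if Aᵗ = I, iterating the relation t times yields
-- (w_k(1) − w_k(i)) · (number of such contributions) = 0, i.e. g ∣ i − 1. The third block is handled
-- in the same way with g = gcd(p,m).

module Submission where

open import Defs
open import Data.Nat using (ℕ; _≤_; _<_; _+_; _∸_)
open import Data.Nat.Divisibility using (_∣_)
open import Data.Nat.GCD using (gcd)
open import Data.Nat.LCM using (lcm)
open import Data.Product using (_×_)
open import Function.Bundles using (_⇔_)
open import Data.Nat as ℕ using (zero; suc; z≤n; s≤s; _*_; _%_; _/_; pred; NonZero)
import Data.Nat.Properties as ℕ
open import Data.Nat.DivMod using (m%n<n; m<n⇒m%n≡m; n%n≡0; [m+kn]%n≡m%n; m≡m%n+[m/n]*n; %-congˡ)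
open import Data.Nat.Divisibility
  using (divides; _∣?_; _∣0; ∣-trans; ∣⇒≤; n∣m*n; ∣m∣n⇒∣m+n; ∣m+n∣m⇒∣n)
open import Data.Nat.GCD using (gcd-GCD; module Bézout; gcd[m,n]∣m; gcd[m,n]∣n; gcd[m,n]≢0)
open import Data.Nat.LCM using (m∣lcm[m,n]; n∣lcm[m,n]; lcm-least; gcd*lcm)
open import Data.Nat.GeneralisedArithmetic using (fold)
open import Data.Nat.Tactic.RingSolver using () renaming (solve-∀ to solveℕ)
open import Data.Integer using (ℤ; 0ℤ; 1ℤ; -_; +[1+_]) renaming (_+_ to _+ℤ_; _*_ to _*ℤ_; _-_ to _-ℤ_)
import Data.Integer.Properties as ℤ
open import Algebra.Properties.AbelianGroup ℤ.+-0-abelianGroup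
  using () renaming (identityʳ-unique to +-identityʳ-unique)
open import Data.Integer.Tactic.RingSolver using (solve-∀)
open import Data.Fin using (Fin; toℕ; fromℕ<; splitAt)
import Data.Fin.Properties as Fin
open import Data.Bool using (true; false; if_then_else_; _∨_; _∧_)
import Data.Bool.Properties as Bool
open import Data.Product using (_,_; proj₁; proj₂; ∃-syntax; map₂)
open import Data.Sum using (_⊎_; inj₁; inj₂)
open import Function using (_∘_)
open import Function.Bundles using (mk⇔; Equivalence)
import Function.Properties.Equivalence as ⇔
open import Relation.Nullary using (¬_; Dec; yes; no; contradiction)
open import Relation.Nullary.Decidable using (⌊_⌋; isYes≗does; dec-true; dec-false)
open import Level using (0ℓ)
open import Relation.Binary.Bundles using (Setoid)
import Relation.Binary.Reasoning.Setoid as SetoidReasoning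
open import Relation.Binary.PropositionalEquality hiding ([_])

⌊⌋-yes : ∀ {A : Set} (a? : Dec A) → A → ⌊ a? ⌋ ≡ true
⌊⌋-yes a? a = trans (isYes≗does a?) (dec-true a? a)

⌊⌋-no : ∀ {A : Set} (a? : Dec A) → ¬ A → ⌊ a? ⌋ ≡ false
⌊⌋-no a? ¬a = trans (isYes≗does a?) (dec-false a? ¬a)

δ : ℕ → ℕ → ℤ
δ x y = bool→ℤ ⌊ x ℕ.≟ y ⌋

δ-≡ : ∀ {x y} → x ≡ y → δ x y ≡ 1ℤ
δ-≡ {x} {y} x≡y with x ℕ.≟ y
... | yes _ = refl
... | no x≢y = contradiction x≡y x≢y

δ-≢ : ∀ {x y} → ¬ x ≡ y → δ x y ≡ 0ℤ
δ-≢ {x} {y} x≢y with x ℕ.≟ y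
... | yes x≡y = contradiction x≡y x≢y
... | no _ = refl

δ-< : ∀ {x y} → x < y → δ x y ≡ 0ℤ
δ-< x<y = δ-≢ (ℕ.<⇒≢ x<y)

δ-> : ∀ {x y} → y < x → δ x y ≡ 0ℤ
δ-> y<x = δ-≢ (ℕ.>⇒≢ y<x)

δ≡1⇒≡ : ∀ {x y} → δ x y ≡ 1ℤ → x ≡ y
δ≡1⇒≡ {x} {y} _ with x ℕ.≟ y
δ≡1⇒≡ _  | yes x≡y = x≡y
δ≡1⇒≡ () | no _

δ-sym : ∀ x y → δ x y ≡ δ y x
δ-sym x y with x ℕ.≟ y
... | yes x≡y = sym (δ-≡ (sym x≡y))
... | no x≢y = sym (δ-≢ (x≢y ∘ sym))

δ-+ˡ : ∀ s x y → δ (s + x) (s + y) ≡ δ x y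
δ-+ˡ s x y with x ℕ.≟ y
... | yes x≡y = δ-≡ (cong (s +_) x≡y)
... | no x≢y = δ-≢ (x≢y ∘ ℕ.+-cancelˡ-≡ s x y)

∑ : ℕ → (ℕ → ℤ) → ℤ
∑ zero    f = 0ℤ
∑ (suc n) f = f 0 +ℤ ∑ n (f ∘ suc)

sumFin≡∑ : ∀ n (f : Fin n → ℤ) (g : ℕ → ℤ) → (∀ c → f c ≡ g (toℕ c)) → sumFin f ≡ ∑ n g
sumFin≡∑ zero    f g f≗g = refl
sumFin≡∑ (suc n) f g f≗g =
  cong₂ _+ℤ_ (f≗g Fin.zero) (sumFin≡∑ n (f ∘ Fin.suc) (g ∘ suc) (f≗g ∘ Fin.suc))

∑-cong : ∀ n {f g} → (∀ c → c < n → f c ≡ g c) → ∑ n f ≡ ∑ n g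
∑-cong zero    f≗g = refl
∑-cong (suc n) f≗g = cong₂ _+ℤ_ (f≗g 0 (s≤s z≤n)) (∑-cong n (λ c c<n → f≗g (suc c) (s≤s c<n)))

∑-zero : ∀ n {f} → (∀ c → c < n → f c ≡ 0ℤ) → ∑ n f ≡ 0ℤ
∑-zero zero    f≗0 = refl
∑-zero (suc n) f≗0 = cong₂ _+ℤ_ (f≗0 0 (s≤s z≤n)) (∑-zero n (λ c c<n → f≗0 (suc c) (s≤s c<n)))

∑-distrib-+ : ∀ n f g → ∑ n (λ c → f c +ℤ g c) ≡ ∑ n f +ℤ ∑ n g
∑-distrib-+ zero    f g = refl
∑-distrib-+ (suc n) f g =
  trans (cong (f 0 +ℤ g 0 +ℤ_) (∑-distrib-+ n (f ∘ suc) (g ∘ suc)))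
        (+-interchange (f 0) (g 0) (∑ n (f ∘ suc)) (∑ n (g ∘ suc)))
  where
  +-interchange : ∀ a b c d → (a +ℤ b) +ℤ (c +ℤ d) ≡ (a +ℤ c) +ℤ (b +ℤ d)
  +-interchange = solve-∀

∑-neg : ∀ n f → ∑ n (λ c → - f c) ≡ - ∑ n f
∑-neg zero    f = refl
∑-neg (suc n) f = trans (cong (- f 0 +ℤ_) (∑-neg n (f ∘ suc))) (sym (ℤ.neg-distrib-+ (f 0) _))

∑-distrib-− : ∀ n f g → ∑ n (λ c → f c -ℤ g c) ≡ ∑ n f -ℤ ∑ n g
∑-distrib-− n f g = trans (∑-distrib-+ n f (λ c → - g c)) (cong (∑ n f +ℤ_) (∑-neg n g))

∑-*ˡ : ∀ n a f → ∑ n (λ c → a *ℤ f c) ≡ a *ℤ ∑ n f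
∑-*ˡ zero    a f = sym (ℤ.*-zeroʳ a)
∑-*ˡ (suc n) a f = trans (cong (a *ℤ f 0 +ℤ_) (∑-*ˡ n a (f ∘ suc))) (sym (ℤ.*-distribˡ-+ a (f 0) _))

∑-*ʳ : ∀ n a f → ∑ n (λ c → f c *ℤ a) ≡ ∑ n f *ℤ a
∑-*ʳ zero    a f = sym (ℤ.*-zeroˡ a)
∑-*ʳ (suc n) a f = trans (cong (f 0 *ℤ a +ℤ_) (∑-*ʳ n a (f ∘ suc))) (sym (ℤ.*-distribʳ-+ a (f 0) _))

∑-comm : ∀ n m (f : ℕ → ℕ → ℤ) → ∑ n (λ c → ∑ m (f c)) ≡ ∑ m (λ d → ∑ n (λ c → f c d))
∑-comm zero    m f = sym (∑-zero m (λ _ _ → refl))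
∑-comm (suc n) m f =
  trans (cong (∑ m (f 0) +ℤ_) (∑-comm n m (f ∘ suc))) (sym (∑-distrib-+ m (f 0) _))

∑-snoc : ∀ n f → ∑ (suc n) f ≡ ∑ n f +ℤ f n
∑-snoc zero    f = trans (ℤ.+-identityʳ (f 0)) (sym (ℤ.+-identityˡ (f 0)))
∑-snoc (suc n) f = trans (cong (f 0 +ℤ_) (∑-snoc n (f ∘ suc))) (sym (ℤ.+-assoc (f 0) _ _))

∑-shift : ∀ n f → ∑ n (f ∘ suc) ≡ ∑ n f +ℤ f n -ℤ f 0
∑-shift n f = trans (+-cancel (f 0) (∑ n (f ∘ suc))) (cong (_-ℤ f 0) (∑-snoc n f))
  where
  +-cancel : ∀ a b → b ≡ (a +ℤ b) -ℤ a
  +-cancel = solve-∀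

∑-δʳ : ∀ n {k} (f : ℕ → ℤ) → k < n → ∑ n (λ c → f c *ℤ δ c k) ≡ f k
∑-δʳ (suc n) {zero} f _ =
  trans (cong₂ _+ℤ_ (ℤ.*-identityʳ (f 0))
                    (∑-zero n (λ c _ → trans (cong (f (suc c) *ℤ_) (δ-> {suc c} (s≤s z≤n)))
                                             (ℤ.*-zeroʳ (f (suc c))))))
        (ℤ.+-identityʳ (f 0))
∑-δʳ (suc n) {suc k} f (s≤s k<n) =
  trans (cong₂ _+ℤ_ (trans (cong (f 0 *ℤ_) (δ-< {0} {suc k} (s≤s z≤n))) (ℤ.*-zeroʳ (f 0)))
                    (∑-cong n {g = λ c → f (suc c) *ℤ δ c k} (λ c _ → cong (f (suc c) *ℤ_) (δ-+ˡ 1 c k))))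
        (trans (ℤ.+-identityˡ _) (∑-δʳ n (f ∘ suc) k<n))

∑-δˡ : ∀ n {k} (f : ℕ → ℤ) → k < n → ∑ n (λ c → δ k c *ℤ f c) ≡ f k
∑-δˡ n {k} f k<n =
  trans (∑-cong n {g = λ c → f c *ℤ δ c k}
                 (λ c _ → trans (ℤ.*-comm (δ k c) (f c)) (cong (f c *ℤ_) (δ-sym k c))))
        (∑-δʳ n f k<n)

-- Matrices are functions ℕ → ℕ → ℤ compared only on [0, n)²; this keeps block decompositions
-- free of Fin arithmetic, and `Represents` transfers results back to `Mat n`.
Mx : Set
Mx = ℕ → ℕ → ℤ

infixl 7 _·[_]_
infix 4 _≈[_]_

_·[_]_ : Mx → ℕ → Mx → Mx
(X ·[ n ] Y) x y = ∑ n (λ c → X x c *ℤ Y c y)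

_^[_]_ : Mx → ℕ → ℕ → Mx
X ^[ n ] zero  = δ
X ^[ n ] suc k = X ·[ n ] (X ^[ n ] k)

_≈[_]_ : Mx → ℕ → Mx → Set
X ≈[ n ] Y = ∀ x y → x < n → y < n → X x y ≡ Y x y

≈-setoid : ℕ → Setoid 0ℓ 0ℓ
≈-setoid n = record
  { Carrier = Mx
  ; _≈_ = _≈[ n ]_
  ; isEquivalence = record
    { refl  = λ _ _ _ _ → refl
    ; sym   = λ X≈Y x y x<n y<n → sym (X≈Y x y x<n y<n)
    ; trans = λ X≈Y Y≈Z x y x<n y<n → trans (X≈Y x y x<n y<n) (Y≈Z x y x<n y<n)
    }
  }

module ≈-Reasoning (n : ℕ) = SetoidReasoning (≈-setoid n)

≈-refl : ∀ {n} X → X ≈[ n ] X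
≈-refl X _ _ _ _ = refl

·-assoc : ∀ n X Y Z → X ·[ n ] Y ·[ n ] Z ≈[ n ] X ·[ n ] (Y ·[ n ] Z)
·-assoc n X Y Z x y _ _ =
  trans (∑-cong n (λ c _ → sym (∑-*ʳ n (Z c y) (λ d → X x d *ℤ Y d c))))
  (trans (∑-comm n n (λ c d → (X x d *ℤ Y d c) *ℤ Z c y))
         (∑-cong n (λ d _ → trans (∑-cong n (λ c _ → ℤ.*-assoc (X x d) (Y d c) (Z c y)))
                                  (∑-*ˡ n (X x d) (λ c → Y d c *ℤ Z c y)))))

·-identityˡ : ∀ n X → δ ·[ n ] X ≈[ n ] X
·-identityˡ n X x y x<n _ = ∑-δˡ n (λ c → X c y) x<n

·-identityʳ : ∀ n X → X ·[ n ] δ ≈[ n ] X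
·-identityʳ n X x y _ y<n = ∑-δʳ n (X x) y<n

·-cong : ∀ n {X X′ Y Y′} → X ≈[ n ] X′ → Y ≈[ n ] Y′ → X ·[ n ] Y ≈[ n ] X′ ·[ n ] Y′
·-cong n X≈X′ Y≈Y′ x y x<n y<n =
  ∑-cong n (λ c c<n → cong₂ _*ℤ_ (X≈X′ x c x<n c<n) (Y≈Y′ c y c<n y<n))

I+_ : Mx → Mx
(I+ N) x y = δ x y +ℤ N x y

neg : Mx → Mx
neg N x y = - N x y

I+N·I+M≈I : ∀ n N M → (∀ x y → N x y +ℤ M x y ≡ 0ℤ) → (∀ x y → (N ·[ n ] M) x y ≡ 0ℤ) →
            I+ N ·[ n ] I+ M ≈[ n ] δ
I+N·I+M≈I n N M N+M≡0 NM≡0 x y x<n y<n = begin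
  ∑ n (λ c → (δ x c +ℤ N x c) *ℤ (δ c y +ℤ M c y))
    ≡⟨ ∑-cong n (λ c _ → expand (δ x c) (N x c) (δ c y) (M c y)) ⟩
  ∑ n (λ c → δ x c *ℤ δ c y +ℤ δ x c *ℤ M c y +ℤ (N x c *ℤ δ c y +ℤ N x c *ℤ M c y))
    ≡⟨ trans (∑-distrib-+ n _ _) (cong₂ _+ℤ_ (∑-distrib-+ n _ _) (∑-distrib-+ n _ _)) ⟩
  (∑ n (λ c → δ x c *ℤ δ c y) +ℤ ∑ n (λ c → δ x c *ℤ M c y))
    +ℤ (∑ n (λ c → N x c *ℤ δ c y) +ℤ (N ·[ n ] M) x y)
    ≡⟨ cong₂ _+ℤ_ (cong₂ _+ℤ_ (∑-δˡ n (λ c → δ c y) x<n) (∑-δˡ n (λ c → M c y) x<n))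
                  (cong₂ _+ℤ_ (∑-δʳ n (N x) y<n) (NM≡0 x y)) ⟩
  (δ x y +ℤ M x y) +ℤ (N x y +ℤ 0ℤ)
    ≡⟨ collect (δ x y) (M x y) (N x y) ⟩
  δ x y +ℤ (N x y +ℤ M x y)
    ≡⟨ cong (δ x y +ℤ_) (N+M≡0 x y) ⟩
  δ x y +ℤ 0ℤ
    ≡⟨ ℤ.+-identityʳ (δ x y) ⟩
  δ x y ∎
  where
  open ≡-Reasoning
  expand : ∀ a b c d → (a +ℤ b) *ℤ (c +ℤ d) ≡ a *ℤ c +ℤ a *ℤ d +ℤ (b *ℤ c +ℤ b *ℤ d)
  expand = solve-∀
  collect : ∀ d m k → (d +ℤ m) +ℤ (k +ℤ 0ℤ) ≡ d +ℤ (k +ℤ m)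
  collect = solve-∀

module _ (n : ℕ) (N : Mx) (N²≡0 : ∀ x y → (N ·[ n ] N) x y ≡ 0ℤ) where

  private
    N+negN≡0 : ∀ x y → N x y +ℤ neg N x y ≡ 0ℤ
    N+negN≡0 x y = ℤ.+-inverseʳ (N x y)

    negN+N≡0 : ∀ x y → neg N x y +ℤ N x y ≡ 0ℤ
    negN+N≡0 x y = ℤ.+-inverseˡ (N x y)

  I+N·I-N≈I : I+ N ·[ n ] I+ neg N ≈[ n ] δ
  I+N·I-N≈I = I+N·I+M≈I n N (neg N) N+negN≡0 λ x y →
    trans (∑-cong n (λ c _ → sym (ℤ.neg-distribʳ-* (N x c) (N c y))))
          (trans (∑-neg n _) (cong -_ (N²≡0 x y)))

  I-N·I+N≈I : I+ neg N ·[ n ] I+ N ≈[ n ] δ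
  I-N·I+N≈I = I+N·I+M≈I n (neg N) N negN+N≡0 λ x y →
    trans (∑-cong n (λ c _ → sym (ℤ.neg-distribˡ-* (N x c) (N c y))))
          (trans (∑-neg n _) (cong -_ (N²≡0 x y)))

module Conjugation (n : ℕ) {A B S S′ : Mx}
  (SS′≈I : S ·[ n ] S′ ≈[ n ] δ) (S′S≈I : S′ ·[ n ] S ≈[ n ] δ)
  (SA≈BS : S ·[ n ] A ≈[ n ] B ·[ n ] S) where

  open ≈-Reasoning n

  ^-conj : ∀ k → S ·[ n ] (A ^[ n ] k) ≈[ n ] (B ^[ n ] k) ·[ n ] S
  ^-conj zero = begin
    S ·[ n ] δ ≈⟨ ·-identityʳ n S ⟩
    S          ≈⟨ ·-identityˡ n S ⟨
    δ ·[ n ] S ∎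
  ^-conj (suc k) = begin
    S ·[ n ] (A ·[ n ] A ^[ n ] k)   ≈⟨ ·-assoc n S A (A ^[ n ] k) ⟨
    S ·[ n ] A ·[ n ] A ^[ n ] k     ≈⟨ ·-cong n SA≈BS (≈-refl (A ^[ n ] k)) ⟩
    B ·[ n ] S ·[ n ] A ^[ n ] k     ≈⟨ ·-assoc n B S (A ^[ n ] k) ⟩
    B ·[ n ] (S ·[ n ] A ^[ n ] k)   ≈⟨ ·-cong n (≈-refl B) (^-conj k) ⟩
    B ·[ n ] (B ^[ n ] k ·[ n ] S)   ≈⟨ ·-assoc n B (B ^[ n ] k) S ⟨
    B ·[ n ] B ^[ n ] k ·[ n ] S     ∎

  ^≈I⇒^≈I : ∀ k → A ^[ n ] k ≈[ n ] δ → B ^[ n ] k ≈[ n ] δ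
  ^≈I⇒^≈I k Aᵏ≈I = begin
    B ^[ n ] k                       ≈⟨ ·-identityʳ n (B ^[ n ] k) ⟨
    B ^[ n ] k ·[ n ] δ              ≈⟨ ·-cong n (≈-refl (B ^[ n ] k)) SS′≈I ⟨
    B ^[ n ] k ·[ n ] (S ·[ n ] S′)  ≈⟨ ·-assoc n (B ^[ n ] k) S S′ ⟨
    B ^[ n ] k ·[ n ] S ·[ n ] S′    ≈⟨ ·-cong n (^-conj k) (≈-refl S′) ⟨
    S ·[ n ] A ^[ n ] k ·[ n ] S′    ≈⟨ ·-cong n (·-cong n (≈-refl S) Aᵏ≈I) (≈-refl S′) ⟩
    S ·[ n ] δ ·[ n ] S′             ≈⟨ ·-cong n (·-identityʳ n S) (≈-refl S′) ⟩
    S ·[ n ] S′                      ≈⟨ SS′≈I ⟩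
    δ                                ∎

  ^≈I⇐^≈I : ∀ k → B ^[ n ] k ≈[ n ] δ → A ^[ n ] k ≈[ n ] δ
  ^≈I⇐^≈I k Bᵏ≈I = begin
    A ^[ n ] k                       ≈⟨ ·-identityˡ n (A ^[ n ] k) ⟨
    δ ·[ n ] A ^[ n ] k              ≈⟨ ·-cong n S′S≈I (≈-refl (A ^[ n ] k)) ⟨
    S′ ·[ n ] S ·[ n ] A ^[ n ] k    ≈⟨ ·-assoc n S′ S (A ^[ n ] k) ⟩
    S′ ·[ n ] (S ·[ n ] A ^[ n ] k)  ≈⟨ ·-cong n (≈-refl S′) (^-conj k) ⟩
    S′ ·[ n ] (B ^[ n ] k ·[ n ] S)  ≈⟨ ·-cong n (≈-refl S′) (·-cong n Bᵏ≈I (≈-refl S)) ⟩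
    S′ ·[ n ] (δ ·[ n ] S)           ≈⟨ ·-cong n (≈-refl S′) (·-identityˡ n S) ⟩
    S′ ·[ n ] S                      ≈⟨ S′S≈I ⟩
    δ                                ∎

Represents : ∀ {n} → Mat n → Mx → Set
Represents M X = ∀ a b → M a b ≡ X (toℕ a) (toℕ b)

toMat : ∀ {n} → Mx → Mat n
toMat X a b = X (toℕ a) (toℕ b)

Represents-toMat : ∀ {n} X → Represents {n} (toMat X) X
Represents-toMat X a b = refl

Represents-*M : ∀ {n} {M M′ : Mat n} {X Y} →
                Represents M X → Represents M′ Y → Represents (M *M M′) (X ·[ n ] Y)
Represents-*M {n} M~X M′~Y a b = sumFin≡∑ n _ _ (λ c → cong₂ _*ℤ_ (M~X a c) (M′~Y c b))

Represents-^M : ∀ {n} {M : Mat n} {X} → Represents M X → ∀ k → Represents (M ^M k) (X ^[ n ] k)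
Represents-^M M~X zero    a b = refl
Represents-^M {n} {M} {X} M~X (suc k) =
  Represents-*M {M = M} {M ^M k} {X} {X ^[ n ] k} M~X (Represents-^M M~X k)

≈⇒≈M : ∀ {n} {M M′ : Mat n} {X Y} → Represents M X → Represents M′ Y → X ≈[ n ] Y → M ≈M M′
≈⇒≈M M~X M′~Y X≈Y a b = trans (M~X a b) (trans (X≈Y _ _ (Fin.toℕ<n a) (Fin.toℕ<n b)) (sym (M′~Y a b)))

≈M⇒≈ : ∀ {n} {M M′ : Mat n} {X Y} → Represents M X → Represents M′ Y → M ≈M M′ → X ≈[ n ] Y
≈M⇒≈ {X = X} {Y} M~X M′~Y M≈M′ x y x<n y<n =
  subst₂ (λ u v → X u v ≡ Y u v) (Fin.toℕ-fromℕ< x<n) (Fin.toℕ-fromℕ< y<n)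
    (trans (sym (M~X (fromℕ< x<n) (fromℕ< y<n))) (trans (M≈M′ _ _) (M′~Y _ _)))

-- Cyclic shifts

next : ℕ → ℕ → ℕ
next L j = if ⌊ suc j ℕ.≟ L ⌋ then 0 else suc j

prev : ℕ → ℕ → ℕ
prev L zero    = L ∸ 1
prev L (suc j) = j

data NextView (L j : ℕ) : Set where
  wrap : suc j ≡ L → next L j ≡ 0 → NextView L j
  step : suc j < L → next L j ≡ suc j → NextView L j

next-view : ∀ L j → j < L → NextView L j
next-view L j j<L with suc j ℕ.≟ L
... | yes 1+j≡L = wrap 1+j≡L (cong (if_then 0 else suc j) (⌊⌋-yes (suc j ℕ.≟ L) 1+j≡L))
... | no 1+j≢L = step (ℕ.≤∧≢⇒< j<L 1+j≢L) (cong (if_then 0 else suc j) (⌊⌋-no (suc j ℕ.≟ L) 1+j≢L))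

next-< : ∀ {L j} → j < L → next L j < L
next-< {L} {j} j<L with next-view L j j<L
... | wrap _ eq rewrite eq = ℕ.≤-trans (s≤s z≤n) j<L
... | step 1+j<L eq rewrite eq = 1+j<L

prev-< : ∀ {L j} → j < L → prev L j < L
prev-< {suc L} {zero} _ = ℕ.n<1+n L
prev-< {suc L} {suc j} j<L = ℕ.<-trans (ℕ.n<1+n j) j<L

prev-next : ∀ {L j} → j < L → prev L (next L j) ≡ j
prev-next {L} {j} j<L with next-view L j j<L
... | wrap 1+j≡L eq rewrite eq | sym 1+j≡L = refl
... | step _ eq rewrite eq = refl

next-prev : ∀ {L j} → j < L → next L (prev L j) ≡ j
next-prev {suc L} {zero} _ with next-view (suc L) L ℕ.≤-refl
... | wrap _ eq = eq
... | step L<L _ = contradiction L<L (ℕ.n≮n (suc L))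
next-prev {suc L} {suc j} (s≤s j<L) with next-view (suc L) j (ℕ.<-trans j<L (ℕ.n<1+n L))
... | wrap refl _ = contradiction j<L (ℕ.n≮n j)
... | step _ eq = eq

δ-next : ∀ {L z a} → z < L → a < L → δ (next L z) a ≡ δ z (prev L a)
δ-next {L} {z} {a} z<L a<L = by-cases (z ℕ.≟ prev L a)
  where
  by-cases : Dec (z ≡ prev L a) → δ (next L z) a ≡ δ z (prev L a)
  by-cases (yes z≡prev-a) = trans (δ-≡ (trans (cong (next L) z≡prev-a) (next-prev a<L))) (sym (δ-≡ z≡prev-a))
  by-cases (no z≢prev-a) =
    trans (δ-≢ λ next-z≡a → z≢prev-a (trans (sym (prev-next z<L)) (cong (prev L) next-z≡a)))
          (sym (δ-≢ z≢prev-a))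

module _ (L : ℕ) .{{_ : NonZero L}} where

  suc-% : ∀ z → suc z % L ≡ suc (z % L) % L
  suc-% z = begin
    suc z % L                       ≡⟨ %-congˡ (cong suc (m≡m%n+[m/n]*n z L)) ⟩
    (suc (z % L) + z / L * L) % L   ≡⟨ [m+kn]%n≡m%n (suc (z % L)) (z / L) L ⟩
    suc (z % L) % L                 ∎
    where open ≡-Reasoning

  next-% : ∀ z → next L (z % L) ≡ suc z % L
  next-% z with next-view L (z % L) (m%n<n z L)
  ... | wrap 1+z%L≡L eq = begin
    next L (z % L)    ≡⟨ eq ⟩
    0                 ≡⟨ n%n≡0 L ⟨
    L % L             ≡⟨ %-congˡ 1+z%L≡L ⟨
    suc (z % L) % L   ≡⟨ suc-% z ⟨
    suc z % L         ∎
    where open ≡-Reasoning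
  ... | step 1+z%L<L eq = trans eq (sym (trans (suc-% z) (m<n⇒m%n≡m 1+z%L<L)))

  fold-next : ∀ {j} t → j < L → fold j (next L) t ≡ (j + t) % L
  fold-next {j} zero    j<L = sym (trans (%-congˡ (ℕ.+-identityʳ j)) (m<n⇒m%n≡m j<L))
  fold-next {j} (suc t) j<L = begin
    next L (fold j (next L) t)  ≡⟨ cong (next L) (fold-next t j<L) ⟩
    next L ((j + t) % L)        ≡⟨ next-% (j + t) ⟩
    suc (j + t) % L             ≡⟨ %-congˡ (ℕ.+-suc j t) ⟨
    (j + suc t) % L             ∎
    where open ≡-Reasoning

  fold-next-* : ∀ {j} w → j < L → fold j (next L) (w * L) ≡ j
  fold-next-* {j} w j<L = trans (fold-next (w * L) j<L) (trans ([m+kn]%n≡m%n j w L) (m<n⇒m%n≡m j<L))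

  fold-next-fixed⇒∣ : ∀ {j} t → j < L → fold j (next L) t ≡ j → L ∣ t
  fold-next-fixed⇒∣ {j} t j<L fixed = divides ((j + t) / L) (ℕ.+-cancelˡ-≡ j t _ (begin
    j + t                          ≡⟨ m≡m%n+[m/n]*n (j + t) L ⟩
    (j + t) % L + (j + t) / L * L  ≡⟨ cong (_+ (j + t) / L * L) (trans (sym (fold-next t j<L)) fixed) ⟩
    j + (j + t) / L * L            ∎))
    where open ≡-Reasoning

δ-fold-next-cases : ∀ {L j} .{{_ : NonZero L}} t → j < L →
  δ j (fold j (next L) t) ≡ 0ℤ ⊎ (δ j (fold j (next L) t) ≡ 1ℤ × L ∣ t)
δ-fold-next-cases {L} {j} t j<L = by-cases (j ℕ.≟ fold j (next L) t)
  where
  by-cases : Dec (j ≡ fold j (next L) t) →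
             δ j (fold j (next L) t) ≡ 0ℤ ⊎ (δ j (fold j (next L) t) ≡ 1ℤ × L ∣ t)
  by-cases (yes fixed) = inj₂ (δ-≡ fixed , fold-next-fixed⇒∣ L t j<L (sym fixed))
  by-cases (no moved)  = inj₁ (δ-≢ moved)

∣-next : ∀ {d L j} c → d ∣ L → j < L → d ∣ next L j + c ⇔ d ∣ j + suc c
∣-next {d} {L} {j} c d∣L j<L with next-view L j j<L
... | wrap 1+j≡L eq rewrite eq = mk⇔
  (λ d∣c → subst (d ∣_) L+c≡j+1+c (∣m∣n⇒∣m+n d∣L d∣c))
  (λ d∣j+1+c → ∣m+n∣m⇒∣n (subst (d ∣_) (sym L+c≡j+1+c) d∣j+1+c) d∣L)
  where
  L+c≡j+1+c : L + c ≡ j + suc c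
  L+c≡j+1+c = trans (cong (_+ c) (sym 1+j≡L)) (sym (ℕ.+-suc j c))
... | step _ eq rewrite eq = mk⇔ (subst (d ∣_) (sym (ℕ.+-suc j c))) (subst (d ∣_) (ℕ.+-suc j c))

fold-pres : ∀ {L} (h : ℕ → ℕ) → (∀ {j} → j < L → h j < L) → ∀ t {j} → j < L → fold j h t < L
fold-pres h h-pres zero    j<L = j<L
fold-pres h h-pres (suc t) j<L = h-pres (fold-pres h h-pres t j<L)

fold-block : ∀ {L} s (f h : ℕ → ℕ) → (∀ {j} → j < L → f (s + j) ≡ s + h j) →
             (∀ {j} → j < L → h j < L) → ∀ t {j} → j < L → fold (s + j) f t ≡ s + fold j h t
fold-block s f h f≗h h-pres zero    j<L = refl
fold-block s f h f≗h h-pres (suc t) j<L =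
  trans (cong f (fold-block s f h f≗h h-pres t j<L)) (f≗h (fold-pres h h-pres t j<L))

-- Block-diagonal matrices and permutation matrices

data Side (k y : ℕ) : Set where
  left  : y < k → Side k y
  right : ∀ j → y ≡ k + j → Side k y

side : ∀ k y → Side k y
side k y with y ℕ.<? k
... | yes y<k = left y<k
... | no y≮k = right (y ∸ k) (sym (ℕ.m+[n∸m]≡n (ℕ.≮⇒≥ y≮k)))

<?-yes : ∀ {y k} → y < k → ⌊ y ℕ.<? k ⌋ ≡ true
<?-yes {y} {k} y<k = ⌊⌋-yes (y ℕ.<? k) y<k

<?-no : ∀ k j → ⌊ k + j ℕ.<? k ⌋ ≡ false
<?-no k j = ⌊⌋-no (k + j ℕ.<? k) (ℕ.≤⇒≯ (ℕ.m≤m+n k j))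

_⊎[_]_ : (ℕ → ℕ) → ℕ → (ℕ → ℕ) → ℕ → ℕ
(f ⊎[ k ] g) y = if ⌊ y ℕ.<? k ⌋ then f y else k + g (y ∸ k)

⊎-left : ∀ {k} f g {y} → y < k → (f ⊎[ k ] g) y ≡ f y
⊎-left f g y<k rewrite <?-yes y<k = refl

⊎-right : ∀ {k} f g j → (f ⊎[ k ] g) (k + j) ≡ k + g j
⊎-right {k} f g j rewrite <?-no k j | ℕ.m+n∸m≡n k j = refl

⊎-pres : ∀ {k l} f g → (∀ {y} → y < k → f y < k) → (∀ {y} → y < l → g y < l) →
         ∀ {y} → y < k + l → (f ⊎[ k ] g) y < k + l
⊎-pres {k} {l} f g f-pres g-pres {y} y<k+l with side k y
... | left y<k = subst (_< k + l) (sym (⊎-left f g y<k)) (ℕ.<-≤-trans (f-pres y<k) (ℕ.m≤m+n k l))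
... | right j refl = subst (_< k + l) (sym (⊎-right f g j)) (ℕ.+-monoʳ-< k (g-pres (ℕ.+-cancelˡ-< k _ _ y<k+l)))

_⊕[_]_ : Mx → ℕ → Mx → Mx
(X ⊕[ k ] Y) x y =
  if ⌊ x ℕ.<? k ⌋ then (if ⌊ y ℕ.<? k ⌋ then X x y else 0ℤ)
                  else (if ⌊ y ℕ.<? k ⌋ then 0ℤ else Y (x ∸ k) (y ∸ k))

module _ {k : ℕ} (X Y : Mx) where

  ⊕-ll : ∀ {x y} → x < k → y < k → (X ⊕[ k ] Y) x y ≡ X x y
  ⊕-ll x<k y<k rewrite <?-yes x<k | <?-yes y<k = refl

  ⊕-lr : ∀ {x} j → x < k → (X ⊕[ k ] Y) x (k + j) ≡ 0ℤ
  ⊕-lr j x<k rewrite <?-yes x<k | <?-no k j = refl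

  ⊕-rl : ∀ i {y} → y < k → (X ⊕[ k ] Y) (k + i) y ≡ 0ℤ
  ⊕-rl i y<k rewrite <?-yes y<k | <?-no k i = refl

  ⊕-rr : ∀ i j → (X ⊕[ k ] Y) (k + i) (k + j) ≡ Y i j
  ⊕-rr i j rewrite <?-no k i | <?-no k j | ℕ.m+n∸m≡n k i | ℕ.m+n∸m≡n k j = refl

private
  SplitSpec : ∀ k {l} (a : Fin (k + l)) → Fin k ⊎ Fin l → Set
  SplitSpec k a (inj₁ a′) = toℕ a ≡ toℕ a′ × toℕ a < k
  SplitSpec k a (inj₂ a′) = toℕ a ≡ k + toℕ a′

  splitAt-spec : ∀ k {l} (a : Fin (k + l)) → SplitSpec k a (splitAt k a)
  splitAt-spec zero          a           = refl
  splitAt-spec (suc k)       Fin.zero = refl , s≤s z≤n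
  splitAt-spec (suc k) {l}   (Fin.suc a) with splitAt k {l} a | splitAt-spec k a
  ... | inj₁ a′ | (eq , a<k) = cong suc eq , s≤s a<k
  ... | inj₂ a′ | eq = cong suc eq

Represents-⊕ : ∀ {k l} {A : Mat k} {B : Mat l} {X Y} → Represents A X → Represents B Y →
               Represents (A ⊕ B) (X ⊕[ k ] Y)
Represents-⊕ {k} {X = X} {Y} A~X B~Y a b
  with splitAt k a | splitAt-spec k a | splitAt k b | splitAt-spec k b
... | inj₁ a′ | (eqa , a<k) | inj₁ b′ | (eqb , b<k) =
  trans (A~X a′ b′) (sym (trans (⊕-ll {k} X Y a<k b<k) (cong₂ X eqa eqb)))
... | inj₁ a′ | (_ , a<k) | inj₂ b′ | eqb rewrite eqb = sym (⊕-lr {k} X Y (toℕ b′) a<k)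
... | inj₂ a′ | eqa | inj₁ b′ | (_ , b<k) rewrite eqa = sym (⊕-rl {k} X Y (toℕ a′) b<k)
... | inj₂ a′ | eqa | inj₂ b′ | eqb rewrite eqa | eqb =
  trans (B~Y a′ b′) (sym (⊕-rr {k} X Y (toℕ a′) (toℕ b′)))

colPerm : (ℕ → ℕ) → Mx
colPerm f x y = δ x (f y)

rowPerm : (ℕ → ℕ) → Mx
rowPerm f x y = δ (f x) y

⊕-colPerm : ∀ {k l X Y} f g → (∀ {y} → y < k → f y < k) →
            X ≈[ k ] colPerm f → Y ≈[ l ] colPerm g → X ⊕[ k ] Y ≈[ k + l ] colPerm (f ⊎[ k ] g)
⊕-colPerm {k} {X = X} {Y} f g f-pres X≈f Y≈g c y c<k+l y<k+l with side k c | side k y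
... | left c<k | left y<k =
  trans (⊕-ll {k} X Y c<k y<k) (trans (X≈f c y c<k y<k) (cong (δ c) (sym (⊎-left {k} f g y<k))))
... | left c<k | right j refl =
  trans (⊕-lr {k} X Y j c<k)
        (sym (trans (cong (δ c) (⊎-right {k} f g j)) (δ-< (ℕ.<-≤-trans c<k (ℕ.m≤m+n k _)))))
... | right i refl | left y<k =
  trans (⊕-rl {k} X Y i y<k)
        (sym (trans (cong (δ (k + i)) (⊎-left {k} f g y<k)) (δ-> (ℕ.<-≤-trans (f-pres y<k) (ℕ.m≤m+n k i)))))
... | right i refl | right j refl =
  trans (⊕-rr {k} X Y i j) (trans (Y≈g i j (ℕ.+-cancelˡ-< k _ _ c<k+l) (ℕ.+-cancelˡ-< k _ _ y<k+l))
                              (sym (trans (cong (δ (k + i)) (⊎-right {k} f g j)) (δ-+ˡ k i (g j)))))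

⊕-rowPerm : ∀ {k l X Y} f g → (∀ {x} → x < k → f x < k) →
            X ≈[ k ] rowPerm f → Y ≈[ l ] rowPerm g → X ⊕[ k ] Y ≈[ k + l ] rowPerm (f ⊎[ k ] g)
⊕-rowPerm {k} {X = X} {Y} f g f-pres X≈f Y≈g x c x<k+l c<k+l with side k x | side k c
... | left x<k | left c<k =
  trans (⊕-ll {k} X Y x<k c<k) (trans (X≈f x c x<k c<k) (cong (λ z → δ z c) (sym (⊎-left {k} f g x<k))))
... | left x<k | right j refl =
  trans (⊕-lr {k} X Y j x<k)
        (sym (trans (cong (λ z → δ z (k + j)) (⊎-left {k} f g x<k))
                    (δ-< (ℕ.<-≤-trans (f-pres x<k) (ℕ.m≤m+n k j)))))
... | right i refl | left c<k =
  trans (⊕-rl {k} X Y i c<k)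
        (sym (trans (cong (λ z → δ z c) (⊎-right {k} f g i)) (δ-> (ℕ.<-≤-trans c<k (ℕ.m≤m+n k _)))))
... | right i refl | right j refl =
  trans (⊕-rr {k} X Y i j) (trans (Y≈g i j (ℕ.+-cancelˡ-< k _ _ x<k+l) (ℕ.+-cancelˡ-< k _ _ c<k+l))
                              (sym (trans (cong (λ z → δ z (k + j)) (⊎-right {k} f g i)) (δ-+ˡ k (g i) j))))

Cℕ : ℕ → Mx
Cℕ k x y = bool→ℤ (⌊ x ℕ.≟ suc y ⌋ ∨ (⌊ x ℕ.≟ 0 ⌋ ∧ ⌊ suc y ℕ.≟ k ⌋))

Represents-C : ∀ k → Represents (C k) (Cℕ k)
Represents-C k a b = refl

C≈colPerm : ∀ k → Cℕ k ≈[ k ] colPerm (next k)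
C≈colPerm k c y c<k y<k with next-view k y y<k
... | wrap 1+y≡k eq
  rewrite eq | ⌊⌋-yes (suc y ℕ.≟ k) 1+y≡k
        | ⌊⌋-no (c ℕ.≟ suc y) (ℕ.<⇒≢ (subst (c <_) (sym 1+y≡k) c<k))
        | Bool.∧-identityʳ ⌊ c ℕ.≟ 0 ⌋ = refl
... | step 1+y<k eq
  rewrite eq | ⌊⌋-no (suc y ℕ.≟ k) (ℕ.<⇒≢ 1+y<k) | Bool.∧-zeroʳ ⌊ c ℕ.≟ 0 ⌋
        | Bool.∨-identityʳ ⌊ c ℕ.≟ suc y ⌋ = refl

C≈rowPerm : ∀ k → Cℕ k ≈[ k ] rowPerm (prev k)
C≈rowPerm (suc k) zero    c _ c<k = trans (δ-+ˡ 1 c k) (δ-sym c k)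
C≈rowPerm (suc k) (suc x) c _ c<k rewrite Bool.∨-identityʳ ⌊ suc x ℕ.≟ suc c ⌋ = δ-+ˡ 1 x c

·-unitRow : ∀ n X Y x y {r} → r < n → (∀ c → c < n → X x c ≡ δ r c) → (X ·[ n ] Y) x y ≡ Y r y
·-unitRow n X Y x y r<n row =
  trans (∑-cong n (λ c c<n → cong (_*ℤ Y c y) (row c c<n))) (∑-δˡ n (λ c → Y c y) r<n)

·-unitCol : ∀ n X Y x y {r} → r < n → (∀ c → c < n → Y c y ≡ δ c r) → (X ·[ n ] Y) x y ≡ X x r
·-unitCol n X Y x y r<n col =
  trans (∑-cong n (λ c c<n → cong (X x c *ℤ_) (col c c<n))) (∑-δʳ n (X x) r<n)

^-colPerm : ∀ {n X} f → (∀ {y} → y < n → f y < n) → X ≈[ n ] colPerm f →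
            ∀ t → X ^[ n ] t ≈[ n ] colPerm (λ y → fold y f t)
^-colPerm f f-pres X≈f zero    c y _ _ = refl
^-colPerm {n} {X} f f-pres X≈f (suc t) c y c<n y<n =
  trans (·-unitCol n X (X ^[ n ] t) c y (fold-pres f f-pres t y<n) (λ e e<n → ^-colPerm f f-pres X≈f t e y e<n y<n))
        (X≈f c _ c<n (fold-pres f f-pres t y<n))

_++[_]_ : (ℕ → ℤ) → ℕ → (ℕ → ℤ) → ℕ → ℤ
(a ++[ k ] b) c = if ⌊ c ℕ.<? k ⌋ then a c else b (c ∸ k)

++-left : ∀ {k} a b {c} → c < k → (a ++[ k ] b) c ≡ a c
++-left a b c<k rewrite <?-yes c<k = refl

++-right : ∀ {k} a b j → (a ++[ k ] b) (k + j) ≡ b j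
++-right {k} a b j rewrite <?-no k j | ℕ.m+n∸m≡n k j = refl

module ThreeCycles (p q m : ℕ) where

  n : ℕ
  n = p + q + m

  Pℕ : Mx
  Pℕ = (Cℕ p ⊕[ p ] Cℕ q) ⊕[ p + q ] Cℕ m

  σ₁₂ τ₁₂ σ τ : ℕ → ℕ
  σ₁₂ = next p ⊎[ p ] next q
  τ₁₂ = prev p ⊎[ p ] prev q
  σ = σ₁₂ ⊎[ p + q ] next m
  τ = τ₁₂ ⊎[ p + q ] prev m

  Represents-P : Represents ((C p ⊕ C q) ⊕ C m) Pℕ
  Represents-P =
    Represents-⊕ {A = C p ⊕ C q} {C m} {Cℕ p ⊕[ p ] Cℕ q} {Cℕ m}
      (Represents-⊕ {A = C p} {C q} {Cℕ p} {Cℕ q} (Represents-C p) (Represents-C q)) (Represents-C m)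

  σ-< : ∀ {y} → y < n → σ y < n
  σ-< = ⊎-pres σ₁₂ (next m) (⊎-pres (next p) (next q) next-< next-<) next-<

  τ-< : ∀ {y} → y < n → τ y < n
  τ-< = ⊎-pres τ₁₂ (prev m) (⊎-pres (prev p) (prev q) prev-< prev-<) prev-<

  P≈colPerm : Pℕ ≈[ n ] colPerm σ
  P≈colPerm = ⊕-colPerm σ₁₂ (next m) (⊎-pres (next p) (next q) next-< next-<)
    (⊕-colPerm (next p) (next q) next-< (C≈colPerm p) (C≈colPerm q)) (C≈colPerm m)

  P≈rowPerm : Pℕ ≈[ n ] rowPerm τ
  P≈rowPerm = ⊕-rowPerm τ₁₂ (prev m) (⊎-pres (prev p) (prev q) prev-< prev-<)
    (⊕-rowPerm (prev p) (prev q) prev-< (C≈rowPerm p) (C≈rowPerm q)) (C≈rowPerm m)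

  P-row : ∀ {x} → x < n → ∀ c → c < n → Pℕ x c ≡ δ (τ x) c
  P-row {x} x<n c c<n = P≈rowPerm x c x<n c<n

  data Position (y : ℕ) : Set where
    in₁ : y < p → Position y
    in₂ : ∀ j → j < q → y ≡ p + j → Position y
    in₃ : ∀ j → j < m → y ≡ p + q + j → Position y

  position : ∀ {y} → y < n → Position y
  position {y} y<n with side p y
  ... | left y<p = in₁ y<p
  ... | right j refl with side q j
  ...   | left j<q = in₂ j j<q refl
  ...   | right j′ refl = in₃ j′ (ℕ.+-cancelˡ-< (p + q) _ _ (subst (_< n) (sym (ℕ.+-assoc p q j′)) y<n))
                              (sym (ℕ.+-assoc p q j′))

  private
    <p⇒<p+q : ∀ {j} → j < p → j < p + q
    <p⇒<p+q j<p = ℕ.<-≤-trans j<p (ℕ.m≤m+n p q)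

  σ-in₁ : ∀ {j} → j < p → σ j ≡ next p j
  σ-in₁ j<p = trans (⊎-left {p + q} σ₁₂ (next m) (<p⇒<p+q j<p)) (⊎-left {p} (next p) (next q) j<p)

  σ-in₂ : ∀ {j} → j < q → σ (p + j) ≡ p + next q j
  σ-in₂ {j} j<q = trans (⊎-left {p + q} σ₁₂ (next m) (ℕ.+-monoʳ-< p j<q)) (⊎-right {p} (next p) (next q) j)

  σ-in₃ : ∀ j → σ (p + q + j) ≡ p + q + next m j
  σ-in₃ j = ⊎-right {p + q} σ₁₂ (next m) j

  τ-in₁ : ∀ {j} → j < p → τ j ≡ prev p j
  τ-in₁ j<p = trans (⊎-left {p + q} τ₁₂ (prev m) (<p⇒<p+q j<p)) (⊎-left {p} (prev p) (prev q) j<p)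

  τ-in₂ : ∀ {j} → j < q → τ (p + j) ≡ p + prev q j
  τ-in₂ {j} j<q = trans (⊎-left {p + q} τ₁₂ (prev m) (ℕ.+-monoʳ-< p j<q)) (⊎-right {p} (prev p) (prev q) j)

  τ-in₃ : ∀ j → τ (p + q + j) ≡ p + q + prev m j
  τ-in₃ j = ⊎-right {p + q} τ₁₂ (prev m) j

  fold-σ-in₁ : ∀ t {j} → j < p → fold j σ t ≡ fold j (next p) t
  fold-σ-in₁ = fold-block 0 σ (next p) σ-in₁ next-<

  fold-σ-in₂ : ∀ t {j} → j < q → fold (p + j) σ t ≡ p + fold j (next q) t
  fold-σ-in₂ = fold-block p σ (next q) σ-in₂ next-<

  fold-σ-in₃ : ∀ t {j} → j < m → fold (p + q + j) σ t ≡ p + q + fold j (next m) t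
  fold-σ-in₃ = fold-block (p + q) σ (next m) (λ {j} _ → σ-in₃ j) next-<

  P^≈colPerm : ∀ t → Pℕ ^[ n ] t ≈[ n ] colPerm (λ y → fold y σ t)
  P^≈colPerm = ^-colPerm σ σ-< P≈colPerm

  module _ .{{_ : NonZero p}} .{{_ : NonZero q}} .{{_ : NonZero m}} where

    private
      0<p : 0 < p
      0<p = ℕ.>-nonZero⁻¹ p
      0<q : 0 < q
      0<q = ℕ.>-nonZero⁻¹ q
      0<m : 0 < m
      0<m = ℕ.>-nonZero⁻¹ m

      p+0<n : p + 0 < n
      p+0<n = ℕ.<-≤-trans (ℕ.+-monoʳ-< p 0<q) (ℕ.m≤m+n (p + q) m)

      p+q+0<n : p + q + 0 < n
      p+q+0<n = ℕ.+-monoʳ-< (p + q) 0<m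

      0<n : 0 < n
      0<n = ℕ.≤-trans (s≤s z≤n) p+0<n

    fold-σ-fixed : ∀ t → Pℕ ^[ n ] t ≈[ n ] δ → ∀ {y} → y < n → fold y σ t ≡ y
    fold-σ-fixed t Pᵗ≈I {y} y<n =
      sym (δ≡1⇒≡ (trans (sym (P^≈colPerm t y y y<n y<n)) (trans (Pᵗ≈I y y y<n y<n) (δ-≡ refl))))

    P^≈I⇔ : ∀ t → Pℕ ^[ n ] t ≈[ n ] δ ⇔ (p ∣ t × q ∣ t × m ∣ t)
    P^≈I⇔ t = mk⇔ divides-all fixes-all
      where
      divides-all : Pℕ ^[ n ] t ≈[ n ] δ → p ∣ t × q ∣ t × m ∣ t
      divides-all Pᵗ≈I =
        fold-next-fixed⇒∣ p t 0<p (trans (sym (fold-σ-in₁ t 0<p)) (fold-σ-fixed t Pᵗ≈I 0<n)) ,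
        fold-next-fixed⇒∣ q t 0<q
          (ℕ.+-cancelˡ-≡ p _ _ (trans (sym (fold-σ-in₂ t 0<q)) (fold-σ-fixed t Pᵗ≈I p+0<n))) ,
        fold-next-fixed⇒∣ m t 0<m
          (ℕ.+-cancelˡ-≡ (p + q) _ _ (trans (sym (fold-σ-in₃ t 0<m)) (fold-σ-fixed t Pᵗ≈I p+q+0<n)))

      fixes-all : p ∣ t × q ∣ t × m ∣ t → Pℕ ^[ n ] t ≈[ n ] δ
      fixes-all (divides a t≡ap , divides b t≡bq , divides c t≡cm) x y x<n y<n =
        trans (P^≈colPerm t x y x<n y<n) (cong (δ x) (fixed (position y<n)))
        where
        fixed : ∀ {y} → Position y → fold y σ t ≡ y
        fixed (in₁ y<p) =
          trans (fold-σ-in₁ t y<p) (trans (cong (fold _ (next p)) t≡ap) (fold-next-* p a y<p))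
        fixed (in₂ j j<q refl) =
          trans (fold-σ-in₂ t j<q) (cong (p +_) (trans (cong (fold j (next q)) t≡bq) (fold-next-* q b j<q)))
        fixed (in₃ j j<m refl) =
          trans (fold-σ-in₃ t j<m) (cong (p + q +_) (trans (cong (fold j (next m)) t≡cm) (fold-next-* m c j<m)))

-- Arithmetic progressions modulo p

module _ (p : ℕ) .{{_ : NonZero p}} where

  visits : ℕ → ℕ → ℕ → ℕ → ℤ
  visits s r j a = ∑ r (λ k → δ ((k * s + j) % p) a)

  visits-suc : ∀ s r j {a} → a < p → visits s r (suc j) a ≡ visits s r j (prev p a)
  visits-suc s r j {a} a<p = ∑-cong r λ k _ → begin
    δ ((k * s + suc j) % p) a         ≡⟨ cong (λ z → δ (z % p) a) (ℕ.+-suc (k * s) j) ⟩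
    δ (suc (k * s + j) % p) a         ≡⟨ cong (λ z → δ z a) (next-% p (k * s + j)) ⟨
    δ (next p ((k * s + j) % p)) a    ≡⟨ δ-next (m%n<n (k * s + j) p) a<p ⟩
    δ ((k * s + j) % p) (prev p a)    ∎
    where open ≡-Reasoning

  visits-period : ∀ s r {a b} → (r * s) % p ≡ b → visits s r s a ≡ visits s r 0 a +ℤ δ b a -ℤ δ 0 a
  visits-period s r {a} {b} rs≡b = trans
    (∑-cong r λ k _ →
       cong (λ z → δ (z % p) a) (trans (ℕ.+-comm (k * s) s) (sym (ℕ.+-identityʳ (s + k * s)))))
    (trans (∑-shift r (λ k → δ ((k * s + 0) % p) a))
           (cong₂ (λ z w → visits s r 0 a +ℤ δ z a -ℤ δ w a)
                  (trans (%-congˡ (ℕ.+-identityʳ (r * s))) rs≡b)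
                  (m<n⇒m%n≡m (ℕ.>-nonZero⁻¹ p))))

  %-≡-via-multiples : ∀ {r s a b c} → r * s + a * p ≡ c + b * p → (r * s) % p ≡ c % p
  %-≡-via-multiples {r} {s} {a} {b} {c} eq = begin
    (r * s) % p          ≡⟨ [m+kn]%n≡m%n (r * s) a p ⟨
    (r * s + a * p) % p  ≡⟨ %-congˡ eq ⟩
    (c + b * p) % p      ≡⟨ [m+kn]%n≡m%n c b p ⟩
    c % p                ∎
    where open ≡-Reasoning

  congruence-solvable : ∀ s c → gcd p s ∣ c → ∃[ r ] (r * s) % p ≡ c % p
  congruence-solvable s c (divides w c≡wd) with Bézout.identity (gcd-GCD p s)
  ... | Bézout.-+ x y d+xp≡ys = w * y , %-≡-via-multiples {w * y} {s} {0} {w * x} (begin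
    w * y * s + 0 * p   ≡⟨ regroup w y s p ⟩
    w * (y * s)         ≡⟨ cong (w *_) d+xp≡ys ⟨
    w * (d + x * p)     ≡⟨ ℕ.*-distribˡ-+ w d (x * p) ⟩
    w * d + w * (x * p) ≡⟨ cong₂ _+_ (sym c≡wd) (sym (ℕ.*-assoc w x p)) ⟩
    c + w * x * p       ∎)
    where
    open ≡-Reasoning
    d = gcd p s
    regroup : ∀ w y s p → w * y * s + 0 * p ≡ w * (y * s)
    regroup = solveℕ
  ... | Bézout.+- x y d+ys≡xp =
    w * y * (p ∸ 1) , %-≡-via-multiples {w * y * (p ∸ 1)} {s} {w * x} {w * y * s} (begin
    w * y * (p ∸ 1) * s + w * x * p      ≡⟨ cong (w * y * (p ∸ 1) * s +_) (ℕ.*-assoc w x p) ⟩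
    w * y * (p ∸ 1) * s + w * (x * p)    ≡⟨ cong (λ z → w * y * (p ∸ 1) * s + w * z) d+ys≡xp ⟨
    w * y * (p ∸ 1) * s + w * (d + y * s) ≡⟨ regroup w y s d (p ∸ 1) ⟩
    w * d + w * y * s * suc (p ∸ 1)       ≡⟨ cong₂ (λ z k → z + w * y * s * k) (sym c≡wd) (ℕ.suc-pred p) ⟩
    c + w * y * s * p                     ∎)
    where
    open ≡-Reasoning
    d = gcd p s
    regroup : ∀ w y s d p′ → w * y * p′ * s + w * (d + y * s) ≡ w * d + w * y * s * suc p′
    regroup = solveℕ

-- The matrix A = P + u vᵀ

module Setting (p q m i : ℕ) (2≤p : 2 ≤ p) (1≤q : 1 ≤ q) (1≤m : 1 ≤ m) (1<i : 1 < i) (i≤p : i ≤ p) where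

  open ThreeCycles p q m public

  instance
    p-nonZero : NonZero p
    p-nonZero = ℕ.>-nonZero (ℕ.<-trans (s≤s z≤n) 2≤p)
    q-nonZero : NonZero q
    q-nonZero = ℕ.>-nonZero 1≤q
    m-nonZero : NonZero m
    m-nonZero = ℕ.>-nonZero 1≤m

  i₁ dq dm : ℕ
  i₁ = i ∸ 1
  dq = p + (q ∸ 1)
  dm = p + q + (m ∸ 1)

  0<p : 0 < p
  0<p = ℕ.<-trans (s≤s z≤n) 2≤p

  p≤n : p ≤ n
  p≤n = ℕ.≤-trans (ℕ.m≤m+n p q) (ℕ.m≤m+n (p + q) m)

  0<n : 0 < n
  0<n = ℕ.<-≤-trans 0<p p≤n

  i≡1+i₁ : i ≡ suc i₁
  i≡1+i₁ = sym (ℕ.m+[n∸m]≡n (ℕ.<⇒≤ 1<i))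

  i₁<p : i₁ < p
  i₁<p = ℕ.<-≤-trans (subst (i₁ <_) (sym i≡1+i₁) (ℕ.n<1+n i₁)) i≤p

  i₁<n : i₁ < n
  i₁<n = ℕ.<-≤-trans i₁<p p≤n

  q∸1<q : q ∸ 1 < q
  q∸1<q = ℕ.∸-monoʳ-< {q} {1} {0} (s≤s z≤n) 1≤q

  m∸1<m : m ∸ 1 < m
  m∸1<m = ℕ.∸-monoʳ-< {m} {1} {0} (s≤s z≤n) 1≤m

  p+q≡1+dq : p + q ≡ suc dq
  p+q≡1+dq = trans (cong (p +_) (sym (ℕ.m+[n∸m]≡n 1≤q))) (ℕ.+-suc p (q ∸ 1))

  n≡1+dm : n ≡ suc dm
  n≡1+dm = trans (cong (p + q +_) (sym (ℕ.m+[n∸m]≡n 1≤m))) (ℕ.+-suc (p + q) (m ∸ 1))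

  dq<p+q : dq < p + q
  dq<p+q = ℕ.+-monoʳ-< p q∸1<q

  dq<dm : dq < dm
  dq<dm = ℕ.<-≤-trans dq<p+q (ℕ.m≤m+n (p + q) (m ∸ 1))

  dm<n : dm < n
  dm<n = ℕ.+-monoʳ-< (p + q) m∸1<m

  dq<n : dq < n
  dq<n = ℕ.<-trans dq<dm dm<n

  -- Indices are zero-based: rows 0 and i₁ are the paper's rows 1 and i, columns dq and dm its
  -- columns p + q and n, so that T(1, p + q, i, n) = u vᵀ.
  u v : ℕ → ℤ
  u x = δ x 0 -ℤ δ x i₁
  v y = δ y dq -ℤ δ y dm

  Aℕ : Mx
  Aℕ x y = Pℕ x y +ℤ u x *ℤ v y

  Amat : Mat n
  Amat = ((C p ⊕ C q) ⊕ C m) +M T 1 (p + q) i n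

  Represents-A : Represents Amat Aℕ
  Represents-A a b = cong₂ _+ℤ_ (Represents-P a b) (begin
    T 1 (p + q) i n a b
      ≡⟨ factor (δ (suc x) 1) (δ (suc x) i) (δ (suc y) (p + q)) (δ (suc y) n) ⟩
    (δ (suc x) 1 -ℤ δ (suc x) i) *ℤ (δ (suc y) (p + q) -ℤ δ (suc y) n)
      ≡⟨ cong₂ _*ℤ_ (cong₂ _-ℤ_ (δ-+ˡ 1 x 0) (trans (cong (δ (suc x)) i≡1+i₁) (δ-+ˡ 1 x i₁)))
                    (cong₂ _-ℤ_ (trans (cong (δ (suc y)) p+q≡1+dq) (δ-+ˡ 1 y dq))
                                (trans (cong (δ (suc y)) n≡1+dm) (δ-+ˡ 1 y dm))) ⟩
    u x *ℤ v y                                   ∎)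
    where
    open ≡-Reasoning
    x = toℕ a
    y = toℕ b
    factor : ∀ a b c d → (a *ℤ c +ℤ b *ℤ d) -ℤ (a *ℤ d +ℤ b *ℤ c) ≡ (a -ℤ b) *ℤ (c -ℤ d)
    factor = solve-∀

  u-≥p : ∀ {x} → p ≤ x → u x ≡ 0ℤ
  u-≥p p≤x = cong₂ _-ℤ_ (δ-> (ℕ.<-≤-trans 0<p p≤x)) (δ-> (ℕ.<-≤-trans i₁<p p≤x))

  τ-≥p : ∀ {x} → x < n → p ≤ x → p ≤ τ x
  τ-≥p x<n p≤x with position x<n
  ... | in₁ x<p = contradiction x<p (ℕ.≤⇒≯ p≤x)
  ... | in₂ j j<q refl = subst (p ≤_) (sym (τ-in₂ j<q)) (ℕ.m≤m+n p _)
  ... | in₃ j j<m refl = subst (p ≤_) (sym (τ-in₃ j)) (ℕ.≤-trans (ℕ.m≤m+n p q) (ℕ.m≤m+n (p + q) _))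

  A-row-≥p : ∀ {x} → x < n → p ≤ x → ∀ c → c < n → Aℕ x c ≡ δ (τ x) c
  A-row-≥p {x} x<n p≤x c c<n = begin
    Pℕ x c +ℤ u x *ℤ v c   ≡⟨ cong (λ z → Pℕ x c +ℤ z *ℤ v c) (u-≥p p≤x) ⟩
    Pℕ x c +ℤ 0ℤ           ≡⟨ ℤ.+-identityʳ (Pℕ x c) ⟩
    Pℕ x c                 ≡⟨ P-row x<n c c<n ⟩
    δ (τ x) c              ∎
    where open ≡-Reasoning

  A^-row-≥p : ∀ t {x} y → x < n → p ≤ x → (Aℕ ^[ n ] t) x y ≡ (Pℕ ^[ n ] t) x y
  A^-row-≥p zero    y x<n p≤x = refl
  A^-row-≥p (suc t) {x} y x<n p≤x = begin
    (Aℕ ·[ n ] Aℕ ^[ n ] t) x y  ≡⟨ ·-unitRow n Aℕ (Aℕ ^[ n ] t) x y (τ-< x<n) (A-row-≥p x<n p≤x) ⟩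
    (Aℕ ^[ n ] t) (τ x) y         ≡⟨ A^-row-≥p t y (τ-< x<n) (τ-≥p x<n p≤x) ⟩
    (Pℕ ^[ n ] t) (τ x) y         ≡⟨ ·-unitRow n Pℕ (Pℕ ^[ n ] t) x y (τ-< x<n) (P-row x<n) ⟨
    (Pℕ ·[ n ] Pℕ ^[ n ] t) x y  ∎
    where open ≡-Reasoning

  row·A : ∀ (w : ℕ → ℤ) {e} → e < n →
          ∑ n (λ c → w c *ℤ Aℕ c e) ≡ w (σ e) +ℤ (w 0 -ℤ w i₁) *ℤ v e
  row·A w {e} e<n = begin
    ∑ n (λ c → w c *ℤ Aℕ c e)
      ≡⟨ trans (∑-cong n (λ c _ → ℤ.*-distribˡ-+ (w c) _ _)) (∑-distrib-+ n _ _) ⟩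
    ∑ n (λ c → w c *ℤ Pℕ c e) +ℤ ∑ n (λ c → w c *ℤ (u c *ℤ v e))
      ≡⟨ cong₂ _+ℤ_ (·-unitCol n (λ _ → w) Pℕ 0 e (σ-< e<n) (λ c c<n → P≈colPerm c e c<n e<n))
                    (trans (∑-cong n (λ c _ → sym (ℤ.*-assoc (w c) (u c) (v e)))) (∑-*ʳ n (v e) _)) ⟩
    w (σ e) +ℤ ∑ n (λ c → w c *ℤ u c) *ℤ v e
      ≡⟨ cong (λ z → w (σ e) +ℤ z *ℤ v e)
              (trans (∑-cong n (λ c _ → ℤ.*-distribˡ-+ (w c) (δ c 0) (- δ c i₁)))
              (trans (∑-distrib-+ n _ _)
                     (cong₂ _+ℤ_ (∑-δʳ n w 0<n)
                                 (trans (∑-cong n (λ c _ → sym (ℤ.neg-distribʳ-* (w c) (δ c i₁))))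
                                        (trans (∑-neg n _) (cong -_ (∑-δʳ n w i₁<n))))))) ⟩
    w (σ e) +ℤ (w 0 -ℤ w i₁) *ℤ v e ∎
    where open ≡-Reasoning

  p≤dq : p ≤ dq
  p≤dq = ℕ.m≤m+n p (q ∸ 1)

  p+q≤dm : p + q ≤ dm
  p+q≤dm = ℕ.m≤m+n (p + q) (m ∸ 1)

  v-in₁ : ∀ {y} → y < p → v y ≡ 0ℤ
  v-in₁ y<p = cong₂ _-ℤ_ (δ-< (ℕ.<-≤-trans y<p p≤dq))
                         (δ-< (ℕ.<-≤-trans y<p (ℕ.≤-trans p≤dq (ℕ.<⇒≤ dq<dm))))

  v-in₂ : ∀ {j} → j < q → v (p + j) ≡ δ j (q ∸ 1)
  v-in₂ {j} j<q = begin
    δ (p + j) dq -ℤ δ (p + j) dm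
      ≡⟨ cong₂ _-ℤ_ (δ-+ˡ p j (q ∸ 1)) (δ-< (ℕ.<-≤-trans (ℕ.+-monoʳ-< p j<q) p+q≤dm)) ⟩
    δ j (q ∸ 1) -ℤ 0ℤ
      ≡⟨ ℤ.+-identityʳ _ ⟩
    δ j (q ∸ 1) ∎
    where open ≡-Reasoning

  v-in₃ : ∀ j → v (p + q + j) ≡ - δ j (m ∸ 1)
  v-in₃ j = begin
    δ (p + q + j) dq -ℤ δ (p + q + j) dm
      ≡⟨ cong₂ _-ℤ_ (δ-> (ℕ.<-≤-trans dq<p+q (ℕ.m≤m+n (p + q) j))) (δ-+ˡ (p + q) j (m ∸ 1)) ⟩
    0ℤ -ℤ δ j (m ∸ 1)
      ≡⟨ ℤ.+-identityˡ _ ⟩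
    - δ j (m ∸ 1) ∎
    where open ≡-Reasoning

-- Sufficiency: an explicit conjugator

module Sufficiency (p q m i : ℕ) (2≤p : 2 ≤ p) (1≤q : 1 ≤ q) (1≤m : 1 ≤ m) (1<i : 1 < i) (i≤p : i ≤ p) where

  open Setting p q m i 2≤p 1≤q 1≤m 1<i i≤p

  module Conjugator (r r′ : ℕ) (rq≡i₁ : (r * q) % p ≡ i₁) (r′m≡i₁ : (r′ * m) % p ≡ i₁) where

    -- N lives on the rows of the first block and the columns of the other two, so N² = 0. Its
    -- entries count the visits of the progressions j, j + q, … and j, j + m, … (r resp. r′ terms,
    -- mod p) to the row index; shifting j telescopes, and the congruences on r and r′ make the
    -- wrap-around at the last column of a block produce exactly u, i.e. P N − N P = u vᵀ.
    Nℕ : Mx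
    Nℕ x y =
      if ⌊ x ℕ.<? p ⌋
      then (if ⌊ y ℕ.<? p ⌋ then 0ℤ
            else if ⌊ y ℕ.<? p + q ⌋ then - visits p q r (y ∸ p) x
            else visits p m r′ (y ∸ (p + q)) x)
      else 0ℤ

    N-≥p : ∀ {x} y → p ≤ x → Nℕ x y ≡ 0ℤ
    N-≥p {x} y p≤x rewrite ⌊⌋-no (x ℕ.<? p) (ℕ.≤⇒≯ p≤x) = refl

    N-in₁ : ∀ x {y} → y < p → Nℕ x y ≡ 0ℤ
    N-in₁ x y<p with ⌊ x ℕ.<? p ⌋
    ... | true  rewrite <?-yes y<p = refl
    ... | false = refl

    N-in₂ : ∀ {x j} → x < p → j < q → Nℕ x (p + j) ≡ - visits p q r j x
    N-in₂ {x} {j} x<p j<q rewrite <?-yes x<p | <?-no p j | <?-yes (ℕ.+-monoʳ-< p j<q) | ℕ.m+n∸m≡n p j = refl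

    N-in₃ : ∀ {x} j → x < p → Nℕ x (p + q + j) ≡ visits p m r′ j x
    N-in₃ {x} j x<p
      rewrite <?-yes x<p | <?-no (p + q) j | ℕ.m+n∸m≡n (p + q) j
            | ⌊⌋-no (p + q + j ℕ.<? p) (ℕ.≤⇒≯ (ℕ.≤-trans (ℕ.m≤m+n p q) (ℕ.m≤m+n (p + q) j)))
            = refl

    N² : ∀ x y → (Nℕ ·[ n ] Nℕ) x y ≡ 0ℤ
    N² x y = ∑-zero n λ c _ → vanishes (side p c)
      where
      vanishes : ∀ {c} → Side p c → Nℕ x c *ℤ Nℕ c y ≡ 0ℤ
      vanishes (left c<p) rewrite N-in₁ x c<p = refl
      vanishes (right j refl) rewrite N-≥p y (ℕ.m≤m+n p j) = ℤ.*-zeroʳ (Nℕ x (p + j))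

    private
      δ-last : ∀ {j L} → suc j ≡ L → δ j (L ∸ 1) ≡ 1ℤ
      δ-last refl = δ-≡ refl

      δ-not-last : ∀ {j L} → suc j < L → δ j (L ∸ 1) ≡ 0ℤ
      δ-not-last 1+j<L = δ-< (ℕ.∸-monoˡ-≤ 1 1+j<L)

      annihilate : ∀ a b → a *ℤ 0ℤ +ℤ b ≡ b
      annihilate = solve-∀

    commutator-in₂ : ∀ {x j} → x < p → j < q →
                     u x *ℤ δ j (q ∸ 1) +ℤ Nℕ x (p + next q j) ≡ Nℕ (prev p x) (p + j)
    commutator-in₂ {x} {j} x<p j<q with next-view q j j<q
    ... | step 1+j<q eq rewrite eq | δ-not-last 1+j<q | N-in₂ x<p 1+j<q | N-in₂ (prev-< x<p) j<q
                               | visits-suc p q r j x<p = annihilate (u x) _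
    ... | wrap 1+j≡q eq rewrite eq | δ-last 1+j≡q | N-in₂ x<p (ℕ.≤-trans (s≤s z≤n) j<q)
                               | N-in₂ (prev-< x<p) j<q
                               | sym (visits-suc p q r j x<p) | 1+j≡q | visits-period p q r {x} rq≡i₁
                               | δ-sym i₁ x | δ-sym 0 x =
      telescoped (δ x 0) (δ x i₁) (visits p q r 0 x)
      where
      telescoped : ∀ a b V → (a -ℤ b) *ℤ 1ℤ +ℤ - V ≡ - (V +ℤ b -ℤ a)
      telescoped = solve-∀

    commutator-in₃ : ∀ {x j} → x < p → j < m →
                     u x *ℤ - δ j (m ∸ 1) +ℤ Nℕ x (p + q + next m j) ≡ Nℕ (prev p x) (p + q + j)
    commutator-in₃ {x} {j} x<p j<m with next-view m j j<m
    ... | step 1+j<m eq rewrite eq | δ-not-last 1+j<m | N-in₃ (suc j) x<p | N-in₃ j (prev-< x<p)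
                               | visits-suc p m r′ j x<p = annihilate (u x) _
    ... | wrap 1+j≡m eq rewrite eq | δ-last 1+j≡m | N-in₃ 0 x<p | N-in₃ j (prev-< x<p)
                               | sym (visits-suc p m r′ j x<p) | 1+j≡m | visits-period p m r′ {x} r′m≡i₁
                               | δ-sym i₁ x | δ-sym 0 x =
      telescoped (δ x 0) (δ x i₁) (visits p m r′ 0 x)
      where
      telescoped : ∀ a b V → (a -ℤ b) *ℤ - 1ℤ +ℤ V ≡ V +ℤ b -ℤ a
      telescoped = solve-∀

    commutator : ∀ {x y} → x < n → y < n → u x *ℤ v y +ℤ Nℕ x (σ y) ≡ Nℕ (τ x) y
    commutator {x} {y} x<n y<n with side p x
    ... | right j refl rewrite u-≥p (ℕ.m≤m+n p j) | N-≥p (σ y) (ℕ.m≤m+n p j)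
                             | N-≥p y (τ-≥p x<n (ℕ.m≤m+n p j)) = refl
    ... | left x<p rewrite τ-in₁ x<p with position y<n
    ...   | in₁ y<p rewrite v-in₁ y<p | σ-in₁ y<p | N-in₁ x (next-< y<p) | N-in₁ (prev p x) y<p =
      annihilate (u x) 0ℤ
    ...   | in₂ j j<q refl rewrite v-in₂ j<q | σ-in₂ j<q = commutator-in₂ x<p j<q
    ...   | in₃ j j<m refl rewrite v-in₃ j | σ-in₃ j = commutator-in₃ x<p j<m

    Sℕ S⁻¹ℕ : Mx
    Sℕ = I+ Nℕ
    S⁻¹ℕ = I+ neg Nℕ

    S·A≈P·S : Sℕ ·[ n ] Aℕ ≈[ n ] Pℕ ·[ n ] Sℕ
    S·A≈P·S x y x<n y<n = begin
      ∑ n (λ c → (δ x c +ℤ Nℕ x c) *ℤ Aℕ c y)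
        ≡⟨ trans (∑-cong n (λ c _ → ℤ.*-distribʳ-+ (Aℕ c y) (δ x c) (Nℕ x c))) (∑-distrib-+ n _ _) ⟩
      ∑ n (λ c → δ x c *ℤ Aℕ c y) +ℤ ∑ n (λ c → Nℕ x c *ℤ Aℕ c y)
        ≡⟨ cong₂ _+ℤ_ (∑-δˡ n (λ c → Aℕ c y) x<n) (row·A (Nℕ x) y<n) ⟩
      (Pℕ x y +ℤ u x *ℤ v y) +ℤ (Nℕ x (σ y) +ℤ (Nℕ x 0 -ℤ Nℕ x i₁) *ℤ v y)
        ≡⟨ cong (λ z → (Pℕ x y +ℤ u x *ℤ v y) +ℤ (Nℕ x (σ y) +ℤ z *ℤ v y))
                (cong₂ _-ℤ_ (N-in₁ x 0<p) (N-in₁ x i₁<p)) ⟩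
      (Pℕ x y +ℤ u x *ℤ v y) +ℤ (Nℕ x (σ y) +ℤ 0ℤ *ℤ v y)
        ≡⟨ regroup (Pℕ x y) (u x *ℤ v y) (Nℕ x (σ y)) (v y) ⟩
      Pℕ x y +ℤ (u x *ℤ v y +ℤ Nℕ x (σ y))
        ≡⟨ cong (Pℕ x y +ℤ_) (commutator x<n y<n) ⟩
      Pℕ x y +ℤ Nℕ (τ x) y
        ≡⟨ cong₂ _+ℤ_ (∑-δʳ n (Pℕ x) y<n) (·-unitRow n Pℕ Nℕ x y (τ-< x<n) (P-row x<n)) ⟨
      ∑ n (λ c → Pℕ x c *ℤ δ c y) +ℤ (Pℕ ·[ n ] Nℕ) x y
        ≡⟨ trans (∑-cong n (λ c _ → ℤ.*-distribˡ-+ (Pℕ x c) (δ c y) (Nℕ c y))) (∑-distrib-+ n _ _) ⟨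
      ∑ n (λ c → Pℕ x c *ℤ (δ c y +ℤ Nℕ c y)) ∎
      where
      open ≡-Reasoning
      regroup : ∀ a b c d → (a +ℤ b) +ℤ (c +ℤ 0ℤ *ℤ d) ≡ a +ℤ (b +ℤ c)
      regroup = solve-∀

    open Conjugation n {Aℕ} {Pℕ} {Sℕ} {S⁻¹ℕ} (I+N·I-N≈I n Nℕ N²) (I-N·I+N≈I n Nℕ N²) S·A≈P·S
      public

    A-similar-P : Similar Amat ((C p ⊕ C q) ⊕ C m)
    A-similar-P = toMat Sℕ , toMat S⁻¹ℕ ,
      ≈⇒≈M {X = Sℕ ·[ n ] S⁻¹ℕ}
           (Represents-*M {X = Sℕ} {S⁻¹ℕ} (Represents-toMat Sℕ) (Represents-toMat S⁻¹ℕ))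
           (λ _ _ → refl) (I+N·I-N≈I n Nℕ N²) ,
      ≈⇒≈M {X = S⁻¹ℕ ·[ n ] Sℕ}
           (Represents-*M {X = S⁻¹ℕ} {Sℕ} (Represents-toMat S⁻¹ℕ) (Represents-toMat Sℕ))
           (λ _ _ → refl) (I-N·I+N≈I n Nℕ N²) ,
      ≈⇒≈M (Represents-*M {X = Sℕ} {Aℕ} (Represents-toMat Sℕ) Represents-A)
           (Represents-*M {X = Pℕ} {Sℕ} Represents-P (Represents-toMat Sℕ)) S·A≈P·S

-- Necessity: periodic row vectors

[_∣_] : ℕ → ℕ → ℤ
[ d ∣ a ] = bool→ℤ ⌊ d ∣? a ⌋

[∣]-cong : ∀ {d a b} → d ∣ a ⇔ d ∣ b → [ d ∣ a ] ≡ [ d ∣ b ]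
[∣]-cong {d} {a} {b} d∣a⇔d∣b with d ∣? a | d ∣? b
... | yes _   | yes _   = refl
... | no  _   | no  _   = refl
... | yes d∣a | no d∤b  = contradiction (Equivalence.to d∣a⇔d∣b d∣a) d∤b
... | no d∤a  | yes d∣b = contradiction (Equivalence.from d∣a⇔d∣b d∣b) d∤a

[∣]-yes : ∀ {d a} → d ∣ a → [ d ∣ a ] ≡ 1ℤ
[∣]-yes {d} {a} d∣a with d ∣? a
... | yes _ = refl
... | no d∤a = contradiction d∣a d∤a

[∣]≡1⇒∣ : ∀ {d a} → [ d ∣ a ] ≡ 1ℤ → d ∣ a
[∣]≡1⇒∣ {d} {a} _ with d ∣? a
[∣]≡1⇒∣ _  | yes d∣a = d∣a
[∣]≡1⇒∣ () | no _

∣-+ˡ⇔ : ∀ {d s a} → d ∣ s → d ∣ s + a ⇔ d ∣ a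
∣-+ˡ⇔ d∣s = mk⇔ (λ d∣s+a → ∣m+n∣m⇒∣n d∣s+a d∣s) (∣m∣n⇒∣m+n d∣s)

[∣]-periodic : ∀ {d} a k t → d ∣ t → [ d ∣ a + (k + t) ] ≡ [ d ∣ a + k ]
[∣]-periodic {d} a k t d∣t =
  trans (cong [ d ∣_] (trans (sym (ℕ.+-assoc a k t)) (ℕ.+-comm (a + k) t))) ([∣]-cong (∣-+ˡ⇔ d∣t))

[∣]-next : ∀ {d s L j} k → d ∣ s → d ∣ L → j < L → [ d ∣ s + next L j + k ] ≡ [ d ∣ s + j + suc k ]
[∣]-next {d} {s} {L} {j} k d∣s d∣L j<L = begin
  [ d ∣ s + next L j + k ]     ≡⟨ cong [ d ∣_] (ℕ.+-assoc s (next L j) k) ⟩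
  [ d ∣ s + (next L j + k) ]
    ≡⟨ [∣]-cong (⇔.trans (∣-+ˡ⇔ d∣s) (⇔.trans (∣-next k d∣L j<L) (⇔.sym (∣-+ˡ⇔ d∣s)))) ⟩
  [ d ∣ s + (j + suc k) ]      ≡⟨ cong [ d ∣_] (ℕ.+-assoc s j (suc k)) ⟨
  [ d ∣ s + j + suc k ]        ∎
  where open ≡-Reasoning

∑-01-positive : ∀ t (F : ℕ → ℤ) → (∀ s → F s ≡ 0ℤ ⊎ F s ≡ 1ℤ) → F 0 ≡ 1ℤ →
                ∃[ c ] ∑ (suc t) F ≡ +[1+ c ]
∑-01-positive zero    F F01 F0≡1 = 0 , trans (ℤ.+-identityʳ (F 0)) F0≡1
∑-01-positive (suc t) F F01 F0≡1 with ∑-01-positive t F F01 F0≡1 | F01 (suc t)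
... | c , ∑≡1+c | inj₁ F≡0 = c + 0 , trans (∑-snoc (suc t) F) (cong₂ _+ℤ_ ∑≡1+c F≡0)
... | c , ∑≡1+c | inj₂ F≡1 = c + 1 , trans (∑-snoc (suc t) F) (cong₂ _+ℤ_ ∑≡1+c F≡1)

-- If row vectors W k satisfy W k A = W (k + 1) + D k (e_d − e_d′)ᵀ, then Q t k = W k Aᵗ e_d obeys
-- Q (t + 1) k = Q t (k + 1) + D k E t. When Aᵏ = I, unrolling k steps and using the periodicity
-- of W and D (E t vanishes unless the period divides t) leaves D · (∑ E) = 0 with ∑ E > 0.
module PeriodicRow (n : ℕ) (A : Mx) (g : ℕ) (W : ℕ → ℕ → ℤ) (D E : ℕ → ℤ) {d d′ : ℕ}
  (d<n : d < n) (d′<n : d′ < n) (d≢d′ : ¬ d ≡ d′)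
  (W-step : ∀ k {e} → e < n →
            ∑ n (λ c → W k c *ℤ A c e) ≡ W (suc k) e +ℤ D k *ℤ (δ e d -ℤ δ e d′))
  (W-periodic : ∀ k t {c} → c < n → suc g ∣ t → W (k + t) c ≡ W k c)
  (D-periodic : ∀ k t → suc g ∣ t → D (k + t) ≡ D k)
  (E-def : ∀ t → E t ≡ (A ^[ n ] t) d d -ℤ (A ^[ n ] t) d′ d)
  (E-cases : ∀ t → E t ≡ 0ℤ ⊎ (E t ≡ 1ℤ × suc g ∣ t)) where

  Q : ℕ → ℕ → ℤ
  Q t k = ∑ n (λ c → W k c *ℤ (A ^[ n ] t) c d)

  order⇒E≡1 : ∀ k → A ^[ n ] k ≈[ n ] δ → E k ≡ 1ℤ
  order⇒E≡1 k Aᵏ≈I = trans (E-def k) (cong₂ _-ℤ_ (trans (Aᵏ≈I d d d<n d<n) (δ-≡ {d} refl))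
                                                  (trans (Aᵏ≈I d′ d d′<n d<n) (δ-≢ (d≢d′ ∘ sym))))

  E0≡1 : E 0 ≡ 1ℤ
  E0≡1 = order⇒E≡1 0 (≈-refl δ)

  Q-step : ∀ t k → Q (suc t) k ≡ Q t (suc k) +ℤ D k *ℤ E t
  Q-step t k = begin
    ∑ n (λ c → W k c *ℤ ∑ n (λ e → A c e *ℤ Aᵗ e d))
      ≡⟨ ∑-cong n (λ c _ → sym (∑-*ˡ n (W k c) (λ e → A c e *ℤ Aᵗ e d))) ⟩
    ∑ n (λ c → ∑ n (λ e → W k c *ℤ (A c e *ℤ Aᵗ e d)))
      ≡⟨ ∑-comm n n (λ c e → W k c *ℤ (A c e *ℤ Aᵗ e d)) ⟩
    ∑ n (λ e → ∑ n (λ c → W k c *ℤ (A c e *ℤ Aᵗ e d)))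
      ≡⟨ ∑-cong n (λ e _ → trans (∑-cong n (λ c _ → sym (ℤ.*-assoc (W k c) (A c e) (Aᵗ e d))))
                                 (∑-*ʳ n (Aᵗ e d) (λ c → W k c *ℤ A c e))) ⟩
    ∑ n (λ e → ∑ n (λ c → W k c *ℤ A c e) *ℤ Aᵗ e d)
      ≡⟨ ∑-cong n (λ e e<n → cong (_*ℤ Aᵗ e d) (W-step k e<n)) ⟩
    ∑ n (λ e → (W (suc k) e +ℤ D k *ℤ (δ e d -ℤ δ e d′)) *ℤ Aᵗ e d)
      ≡⟨ ∑-cong n (λ e _ → expand (W (suc k) e) (D k) (δ e d) (δ e d′) (Aᵗ e d)) ⟩
    ∑ n (λ e → W (suc k) e *ℤ Aᵗ e d +ℤ D k *ℤ (Aᵗ e d *ℤ δ e d -ℤ Aᵗ e d *ℤ δ e d′))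
      ≡⟨ trans (∑-distrib-+ n _ _) (cong (Q t (suc k) +ℤ_) (trans (∑-*ˡ n (D k) _) (cong (D k *ℤ_)
           (trans (∑-distrib-− n _ _)
                  (cong₂ _-ℤ_ (∑-δʳ n (λ e → Aᵗ e d) d<n) (∑-δʳ n (λ e → Aᵗ e d) d′<n)))))) ⟩
    Q t (suc k) +ℤ D k *ℤ (Aᵗ d d -ℤ Aᵗ d′ d)
      ≡⟨ cong (λ z → Q t (suc k) +ℤ D k *ℤ z) (E-def t) ⟨
    Q t (suc k) +ℤ D k *ℤ E t ∎
    where
    open ≡-Reasoning
    Aᵗ : Mx
    Aᵗ = A ^[ n ] t
    expand : ∀ w a x y z → (w +ℤ a *ℤ (x -ℤ y)) *ℤ z ≡ w *ℤ z +ℤ a *ℤ (z *ℤ x -ℤ z *ℤ y)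
    expand = solve-∀

  D*E-shift : ∀ k t → D k *ℤ E t ≡ D (k + t) *ℤ E t
  D*E-shift k t with E-cases t
  ... | inj₁ Et≡0 rewrite Et≡0 = trans (ℤ.*-zeroʳ (D k)) (sym (ℤ.*-zeroʳ (D (k + t))))
  ... | inj₂ (_ , g∣t) = cong (_*ℤ E t) (sym (D-periodic k t g∣t))

  unroll : ∀ t k → Q (suc t) k ≡ Q 0 (k + suc t) +ℤ D (k + t) *ℤ ∑ (suc t) E
  unroll zero k = begin
    Q 1 k
      ≡⟨ Q-step 0 k ⟩
    Q 0 (suc k) +ℤ D k *ℤ E 0
      ≡⟨ cong₂ (λ a b → Q 0 a +ℤ D b *ℤ E 0) (ℕ.+-comm 1 k) (sym (ℕ.+-identityʳ k)) ⟩
    Q 0 (k + 1) +ℤ D (k + 0) *ℤ E 0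
      ≡⟨ cong (λ z → Q 0 (k + 1) +ℤ D (k + 0) *ℤ z) (ℤ.+-identityʳ (E 0)) ⟨
    Q 0 (k + 1) +ℤ D (k + 0) *ℤ ∑ 1 E ∎
    where open ≡-Reasoning
  unroll (suc t) k = begin
    Q (2 + t) k
      ≡⟨ Q-step (suc t) k ⟩
    Q (suc t) (suc k) +ℤ D k *ℤ E (suc t)
      ≡⟨ cong₂ _+ℤ_ (unroll t (suc k)) (D*E-shift k (suc t)) ⟩
    Q 0 (suc k + suc t) +ℤ D (suc k + t) *ℤ ∑ (suc t) E +ℤ D (k + suc t) *ℤ E (suc t)
      ≡⟨ cong₂ (λ a b → Q 0 a +ℤ D b *ℤ ∑ (suc t) E +ℤ D (k + suc t) *ℤ E (suc t))
               (sym (ℕ.+-suc k (suc t))) (sym (ℕ.+-suc k t)) ⟩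
    Q 0 (k + suc (suc t)) +ℤ D (k + suc t) *ℤ ∑ (suc t) E +ℤ D (k + suc t) *ℤ E (suc t)
      ≡⟨ factor (Q 0 (k + suc (suc t))) (D (k + suc t)) (∑ (suc t) E) (E (suc t)) ⟩
    Q 0 (k + suc (suc t)) +ℤ D (k + suc t) *ℤ (∑ (suc t) E +ℤ E (suc t))
      ≡⟨ cong (λ z → Q 0 (k + suc (suc t)) +ℤ D (k + suc t) *ℤ z) (∑-snoc (suc t) E) ⟨
    Q 0 (k + suc (suc t)) +ℤ D (k + suc t) *ℤ ∑ (2 + t) E ∎
    where
    open ≡-Reasoning
    factor : ∀ a b c e → a +ℤ b *ℤ c +ℤ b *ℤ e ≡ a +ℤ b *ℤ (c +ℤ e)
    factor = solve-∀

  E-01 : ∀ t → E t ≡ 0ℤ ⊎ E t ≡ 1ℤ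
  E-01 t with E-cases t
  ... | inj₁ Et≡0 = inj₁ Et≡0
  ... | inj₂ (Et≡1 , _) = inj₂ Et≡1

  order⇒D0≡0 : ∀ k → 1 ≤ k → A ^[ n ] k ≈[ n ] δ → D 0 ≡ 0ℤ
  order⇒D0≡0 (suc k′) _ Aᵏ≈I = begin
    D 0                  ≡⟨ D-periodic 0 (k′ * suc g) (n∣m*n k′) ⟨
    D (0 + k′ * suc g)   ≡⟨ cong D (regroup k′ g) ⟨
    D (k₀ + k′)          ≡⟨ ℤ.*-cancelʳ-≡ (D (k₀ + k′)) 0ℤ +[1+ c ] D*[1+c]≡0 ⟩
    0ℤ                   ∎
    where
    open ≡-Reasoning
    regroup : ∀ k g → k * g + k ≡ 0 + k * suc g
    regroup = solveℕ

    g∣k : suc g ∣ suc k′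
    g∣k with E-cases (suc k′)
    ... | inj₁ Ek≡0 = contradiction (trans (sym Ek≡0) (order⇒E≡1 (suc k′) Aᵏ≈I)) λ ()
    ... | inj₂ (_ , g∣k) = g∣k

    -- chosen so that k₀ + k′ = k′ · suc g is a period of D
    k₀ : ℕ
    k₀ = k′ * g

    c : ℕ
    c = proj₁ (∑-01-positive k′ E E-01 E0≡1)

    ∑≡1+c : ∑ (suc k′) E ≡ +[1+ c ]
    ∑≡1+c = proj₂ (∑-01-positive k′ E E-01 E0≡1)


    D*∑≡0 : D (k₀ + k′) *ℤ ∑ (suc k′) E ≡ 0ℤ
    D*∑≡0 = +-identityʳ-unique (Q 0 (k₀ + suc k′)) _ (begin
      Q 0 (k₀ + suc k′) +ℤ D (k₀ + k′) *ℤ ∑ (suc k′) E   ≡⟨ unroll k′ k₀ ⟨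
      Q (suc k′) k₀
        ≡⟨ ∑-cong n (λ c c<n → cong (W k₀ c *ℤ_) (Aᵏ≈I c d c<n d<n)) ⟩
      Q 0 k₀
        ≡⟨ ∑-cong n (λ c c<n → cong (_*ℤ δ c d) (W-periodic k₀ (suc k′) c<n g∣k)) ⟨
      Q 0 (k₀ + suc k′) ∎)

    D*[1+c]≡0 : D (k₀ + k′) *ℤ +[1+ c ] ≡ 0ℤ *ℤ +[1+ c ]
    D*[1+c]≡0 = subst (λ z → D (k₀ + k′) *ℤ z ≡ 0ℤ) ∑≡1+c D*∑≡0

module Necessity (p q m i : ℕ) (2≤p : 2 ≤ p) (1≤q : 1 ≤ q) (1≤m : 1 ≤ m) (1<i : 1 < i) (i≤p : i ≤ p) where

  open Setting p q m i 2≤p 1≤q 1≤m 1<i i≤p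

  A^-in₂ : ∀ t {x j} → x < n → p ≤ x → j < q → (Aℕ ^[ n ] t) x (p + j) ≡ δ x (p + fold j (next q) t)
  A^-in₂ t {x} {j} x<n p≤x j<q =
    trans (A^-row-≥p t (p + j) x<n p≤x)
          (trans (P^≈colPerm t x (p + j) x<n (ℕ.<-≤-trans (ℕ.+-monoʳ-< p j<q) (ℕ.m≤m+n (p + q) m)))
                 (cong (δ x) (fold-σ-in₂ t j<q)))

  A^-in₃ : ∀ t {x j} → x < n → p ≤ x → j < m →
           (Aℕ ^[ n ] t) x (p + q + j) ≡ δ x (p + q + fold j (next m) t)
  A^-in₃ t {x} {j} x<n p≤x j<m =
    trans (A^-row-≥p t (p + q + j) x<n p≤x)
          (trans (P^≈colPerm t x (p + q + j) x<n (ℕ.+-monoʳ-< (p + q) j<m))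
                 (cong (δ x) (fold-σ-in₃ t j<m)))

  private
    <p⇒<p+q : ∀ {c} → c < p → c < p + q
    <p⇒<p+q c<p = ℕ.<-≤-trans c<p (ℕ.m≤m+n p q)

  -- W k is the indicator of {c : suc g ∣ c + k} on the first two blocks; as suc g divides p and q,
  -- the cyclic shift σ moves it to W (k + 1).
  module WitnessQ (g : ℕ) (g∣p : suc g ∣ p) (g∣q : suc g ∣ q) where

    W : ℕ → ℕ → ℤ
    W k = (λ c → [ suc g ∣ c + k ]) ++[ p + q ] (λ _ → 0ℤ)

    W-in : ∀ k {c} → c < p + q → W k c ≡ [ suc g ∣ c + k ]
    W-in k = ++-left {p + q} (λ c → [ suc g ∣ c + k ]) (λ _ → 0ℤ)

    W-out : ∀ k j → W k (p + q + j) ≡ 0ℤ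
    W-out k = ++-right {p + q} (λ c → [ suc g ∣ c + k ]) (λ _ → 0ℤ)

    W-shift : ∀ k {e} → e < n → W k (σ e) ≡ W (suc k) e
    W-shift k e<n with position e<n
    ... | in₁ e<p rewrite σ-in₁ e<p =
      trans (W-in k (<p⇒<p+q (next-< e<p)))
            (trans ([∣]-next {s = 0} k (suc g ∣0) g∣p e<p) (sym (W-in (suc k) (<p⇒<p+q e<p))))
    ... | in₂ j j<q refl rewrite σ-in₂ j<q =
      trans (W-in k (ℕ.+-monoʳ-< p (next-< j<q)))
            (trans ([∣]-next {s = p} k g∣p g∣q j<q) (sym (W-in (suc k) (ℕ.+-monoʳ-< p j<q))))
    ... | in₃ j j<m refl rewrite σ-in₃ j = trans (W-out k (next m j)) (sym (W-out (suc k) j))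

    D : ℕ → ℤ
    D k = W k 0 -ℤ W k i₁

    W-step : ∀ k {e} → e < n →
             ∑ n (λ c → W k c *ℤ Aℕ c e) ≡ W (suc k) e +ℤ D k *ℤ (δ e dq -ℤ δ e dm)
    W-step k {e} e<n = trans (row·A (W k) e<n) (cong (_+ℤ D k *ℤ v e) (W-shift k e<n))

    W-periodic : ∀ k t {c} → c < n → suc g ∣ t → W (k + t) c ≡ W k c
    W-periodic k t {c} _ g∣t with side (p + q) c
    ... | left c<p+q = trans (W-in (k + t) c<p+q) (trans ([∣]-periodic c k t g∣t) (sym (W-in k c<p+q)))
    ... | right j refl = trans (W-out (k + t) j) (sym (W-out k j))

    D-periodic : ∀ k t → suc g ∣ t → D (k + t) ≡ D k
    D-periodic k t g∣t = cong₂ _-ℤ_ (W-periodic k t 0<n g∣t) (W-periodic k t i₁<n g∣t)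

    E : ℕ → ℤ
    E t = (Aℕ ^[ n ] t) dq dq -ℤ (Aℕ ^[ n ] t) dm dq

    E≡δ : ∀ t → E t ≡ δ (q ∸ 1) (fold (q ∸ 1) (next q) t)
    E≡δ t = trans (cong₂ _-ℤ_ (trans (A^-in₂ t dq<n p≤dq q∸1<q) (δ-+ˡ p (q ∸ 1) _))
                              (trans (A^-in₂ t dm<n (ℕ.≤-trans p≤dq (ℕ.<⇒≤ dq<dm)) q∸1<q)
                                     (δ-> (ℕ.<-≤-trans (ℕ.+-monoʳ-< p (fold-pres (next q) next-< t q∸1<q))
                                                       p+q≤dm))))
                  (ℤ.+-identityʳ _)

    E-cases : ∀ t → E t ≡ 0ℤ ⊎ (E t ≡ 1ℤ × suc g ∣ t)
    E-cases t with δ-fold-next-cases t q∸1<q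
    ... | inj₁ δ≡0 = inj₁ (trans (E≡δ t) δ≡0)
    ... | inj₂ (δ≡1 , q∣t) = inj₂ (trans (E≡δ t) δ≡1 , ∣-trans g∣q q∣t)

    open PeriodicRow n Aℕ g W D E dq<n dm<n (ℕ.<⇒≢ dq<dm) W-step W-periodic D-periodic (λ _ → refl) E-cases

    order⇒∣i₁ : ∀ k → 1 ≤ k → Aℕ ^[ n ] k ≈[ n ] δ → suc g ∣ i₁
    order⇒∣i₁ k 1≤k Aᵏ≈I = subst (suc g ∣_) (ℕ.+-identityʳ i₁) ([∣]≡1⇒∣ (begin
      [ suc g ∣ i₁ + 0 ]  ≡⟨ W-in 0 (<p⇒<p+q i₁<p) ⟨
      W 0 i₁              ≡⟨ ℤ.i-j≡0⇒i≡j (W 0 0) (W 0 i₁) (order⇒D0≡0 k 1≤k Aᵏ≈I) ⟨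
      W 0 0               ≡⟨ W-in 0 (<p⇒<p+q 0<p) ⟩
      [ suc g ∣ 0 ]       ≡⟨ [∣]-yes (suc g ∣0) ⟩
      1ℤ                  ∎))
      where open ≡-Reasoning

  module WitnessM (g : ℕ) (g∣p : suc g ∣ p) (g∣m : suc g ∣ m) where

    W₁ W₃ W₂₃ W : ℕ → ℕ → ℤ
    W₁ k c = [ suc g ∣ c + k ]
    W₃ k j = [ suc g ∣ p + j + k ]
    W₂₃ k = (λ _ → 0ℤ) ++[ q ] W₃ k
    W k = W₁ k ++[ p ] W₂₃ k

    W-in₁ : ∀ k {c} → c < p → W k c ≡ [ suc g ∣ c + k ]
    W-in₁ k = ++-left {p} (W₁ k) (W₂₃ k)

    W-in₂ : ∀ k {j} → j < q → W k (p + j) ≡ 0ℤ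
    W-in₂ k {j} j<q = trans (++-right {p} (W₁ k) (W₂₃ k) j) (++-left {q} (λ _ → 0ℤ) (W₃ k) j<q)

    W-in₃ : ∀ k j → W k (p + q + j) ≡ [ suc g ∣ p + j + k ]
    W-in₃ k j = trans (cong (W k) (ℕ.+-assoc p q j))
                      (trans (++-right {p} (W₁ k) (W₂₃ k) (q + j)) (++-right {q} (λ _ → 0ℤ) (W₃ k) j))

    W-shift : ∀ k {e} → e < n → W k (σ e) ≡ W (suc k) e
    W-shift k e<n with position e<n
    ... | in₁ e<p rewrite σ-in₁ e<p =
      trans (W-in₁ k (next-< e<p)) (trans ([∣]-next {s = 0} k (suc g ∣0) g∣p e<p) (sym (W-in₁ (suc k) e<p)))
    ... | in₂ j j<q refl rewrite σ-in₂ j<q = trans (W-in₂ k (next-< j<q)) (sym (W-in₂ (suc k) j<q))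
    ... | in₃ j j<m refl rewrite σ-in₃ j =
      trans (W-in₃ k (next m j)) (trans ([∣]-next {s = p} k g∣p g∣m j<m) (sym (W-in₃ (suc k) j)))

    D : ℕ → ℤ
    D k = W k i₁ -ℤ W k 0

    W-step : ∀ k {e} → e < n →
             ∑ n (λ c → W k c *ℤ Aℕ c e) ≡ W (suc k) e +ℤ D k *ℤ (δ e dm -ℤ δ e dq)
    W-step k {e} e<n = trans (row·A (W k) e<n)
      (cong₂ _+ℤ_ (W-shift k e<n) (flip (W k 0) (W k i₁) (δ e dq) (δ e dm)))
      where
      flip : ∀ a b x y → (a -ℤ b) *ℤ (x -ℤ y) ≡ (b -ℤ a) *ℤ (y -ℤ x)
      flip = solve-∀

    W-periodic : ∀ k t {c} → c < n → suc g ∣ t → W (k + t) c ≡ W k c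
    W-periodic k t c<n g∣t with position c<n
    ... | in₁ c<p = trans (W-in₁ (k + t) c<p) (trans ([∣]-periodic _ k t g∣t) (sym (W-in₁ k c<p)))
    ... | in₂ j j<q refl = trans (W-in₂ (k + t) j<q) (sym (W-in₂ k j<q))
    ... | in₃ j j<m refl = trans (W-in₃ (k + t) j) (trans ([∣]-periodic (p + j) k t g∣t) (sym (W-in₃ k j)))

    D-periodic : ∀ k t → suc g ∣ t → D (k + t) ≡ D k
    D-periodic k t g∣t = cong₂ _-ℤ_ (W-periodic k t i₁<n g∣t) (W-periodic k t 0<n g∣t)

    E : ℕ → ℤ
    E t = (Aℕ ^[ n ] t) dm dm -ℤ (Aℕ ^[ n ] t) dq dm

    E≡δ : ∀ t → E t ≡ δ (m ∸ 1) (fold (m ∸ 1) (next m) t)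
    E≡δ t = trans (cong₂ _-ℤ_ (trans (A^-in₃ t dm<n (ℕ.≤-trans p≤dq (ℕ.<⇒≤ dq<dm)) m∸1<m)
                                     (δ-+ˡ (p + q) (m ∸ 1) _))
                              (trans (A^-in₃ t dq<n p≤dq m∸1<m)
                                     (δ-< (ℕ.<-≤-trans dq<p+q (ℕ.m≤m+n (p + q) _)))))
                  (ℤ.+-identityʳ _)

    E-cases : ∀ t → E t ≡ 0ℤ ⊎ (E t ≡ 1ℤ × suc g ∣ t)
    E-cases t with δ-fold-next-cases t m∸1<m
    ... | inj₁ δ≡0 = inj₁ (trans (E≡δ t) δ≡0)
    ... | inj₂ (δ≡1 , m∣t) = inj₂ (trans (E≡δ t) δ≡1 , ∣-trans g∣m m∣t)

    open PeriodicRow n Aℕ g W D E dm<n dq<n (ℕ.>⇒≢ dq<dm) W-step W-periodic D-periodic (λ _ → refl) E-cases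

    order⇒∣i₁ : ∀ k → 1 ≤ k → Aℕ ^[ n ] k ≈[ n ] δ → suc g ∣ i₁
    order⇒∣i₁ k 1≤k Aᵏ≈I = subst (suc g ∣_) (ℕ.+-identityʳ i₁) ([∣]≡1⇒∣ (begin
      [ suc g ∣ i₁ + 0 ]  ≡⟨ W-in₁ 0 i₁<p ⟨
      W 0 i₁              ≡⟨ ℤ.i-j≡0⇒i≡j (W 0 i₁) (W 0 0) (order⇒D0≡0 k 1≤k Aᵏ≈I) ⟩
      W 0 0               ≡⟨ W-in₁ 0 0<p ⟩
      [ suc g ∣ 0 ]       ≡⟨ [∣]-yes (suc g ∣0) ⟩
      1ℤ                  ∎))
      where open ≡-Reasoning

lcm-nonZero : ∀ m n .{{_ : NonZero m}} .{{_ : NonZero n}} → NonZero (lcm m n)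
lcm-nonZero m n = ℕ.≢-nonZero λ lcm≡0 → ℕ.≢-nonZero⁻¹ (m * n) {{ℕ.m*n≢0 m n}}
  (trans (sym (gcd*lcm m n)) (trans (cong (gcd m n *_) lcm≡0) (ℕ.*-zeroʳ (gcd m n))))

module Theorem (p q m i : ℕ) (2≤p : 2 ≤ p) (1≤q : 1 ≤ q) (1≤m : 1 ≤ m) (1<i : 1 < i) (i≤p : i ≤ p) where

  open Setting p q m i 2≤p 1≤q 1≤m 1<i i≤p
  open Necessity p q m i 2≤p 1≤q 1≤m 1<i i≤p

  L : ℕ
  L = lcm (lcm p q) m

  instance
    L-nonZero : NonZero L
    L-nonZero = lcm-nonZero (lcm p q) m {{lcm-nonZero p q}}

  P^L≈I : Pℕ ^[ n ] L ≈[ n ] δ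
  P^L≈I = Equivalence.from (P^≈I⇔ L)
    ( ∣-trans (m∣lcm[m,n] p q) (m∣lcm[m,n] (lcm p q) m)
    , ∣-trans (n∣lcm[m,n] p q) (m∣lcm[m,n] (lcm p q) m)
    , n∣lcm[m,n] (lcm p q) m )

  P-order-least : ∀ k → 1 ≤ k → Pℕ ^[ n ] k ≈[ n ] δ → L ≤ k
  P-order-least (suc k) _ Pᵏ≈I with Equivalence.to (P^≈I⇔ (suc k)) Pᵏ≈I
  ... | p∣k , q∣k , m∣k = ∣⇒≤ (lcm-least (lcm-least p∣k q∣k) m∣k)

  A^≈I⇔ : ∀ k → (Amat ^M k) ≈M idM ⇔ Aℕ ^[ n ] k ≈[ n ] δ
  A^≈I⇔ k = mk⇔ (≈M⇒≈ (Represents-^M Represents-A k) (λ _ _ → refl))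
                (≈⇒≈M (Represents-^M Represents-A k) (λ _ _ → refl))

  gcd∣i₁-from : ∀ s → (∀ g → suc g ∣ p → suc g ∣ s → suc g ∣ i₁) → gcd p s ∣ i₁
  gcd∣i₁-from s witness =
    subst (_∣ i₁) 1+g≡gcd (witness g (subst (_∣ p) (sym 1+g≡gcd) (gcd[m,n]∣m p s))
                                   (subst (_∣ s) (sym 1+g≡gcd) (gcd[m,n]∣n p s)))
    where
    g : ℕ
    g = pred (gcd p s)
    1+g≡gcd : suc g ≡ gcd p s
    1+g≡gcd = ℕ.suc-pred (gcd p s) {{ℕ.≢-nonZero (gcd[m,n]≢0 p s (inj₁ (ℕ.≢-nonZero⁻¹ p)))}}

  gcd∣i₁ : HasFiniteOrder Amat → gcd p q ∣ i₁ × gcd p m ∣ i₁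
  gcd∣i₁ (k , 1≤k , Aᵏ≈I) =
    gcd∣i₁-from q (λ g g∣p g∣q → WitnessQ.order⇒∣i₁ g g∣p g∣q k 1≤k Aᵏ≈Iℕ) ,
    gcd∣i₁-from m (λ g g∣p g∣m → WitnessM.order⇒∣i₁ g g∣p g∣m k 1≤k Aᵏ≈Iℕ)
    where
    Aᵏ≈Iℕ : Aℕ ^[ n ] k ≈[ n ] δ
    Aᵏ≈Iℕ = Equivalence.to (A^≈I⇔ k) Aᵏ≈I

  multiplier : ∀ s → gcd p s ∣ i₁ → ∃[ r ] (r * s) % p ≡ i₁
  multiplier s gcd∣i₁ =
    map₂ (λ rs≡i₁ → trans rs≡i₁ (m<n⇒m%n≡m i₁<p)) (congruence-solvable p s i₁ gcd∣i₁)

  module _ (gcd∣i₁-q : gcd p q ∣ i₁) (gcd∣i₁-m : gcd p m ∣ i₁) where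

    private
      module S = Sufficiency.Conjugator p q m i 2≤p 1≤q 1≤m 1<i i≤p
        (proj₁ (multiplier q gcd∣i₁-q)) (proj₁ (multiplier m gcd∣i₁-m))
        (proj₂ (multiplier q gcd∣i₁-q)) (proj₂ (multiplier m gcd∣i₁-m))

    A-order : IsOrderOf Amat L
    A-order = ℕ.>-nonZero⁻¹ L , Equivalence.from (A^≈I⇔ L) (S.^≈I⇐^≈I L P^L≈I) ,
      λ k 1≤k Aᵏ≈I → P-order-least k 1≤k (S.^≈I⇒^≈I k (Equivalence.to (A^≈I⇔ k) Aᵏ≈I))

    A-finite-order : HasFiniteOrder Amat
    A-finite-order = L , proj₁ A-order , proj₁ (proj₂ A-order)

    A-similar-P : Similar Amat ((C p ⊕ C q) ⊕ C m)
    A-similar-P = S.A-similar-P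

theorem4p9 : (p q m i : ℕ) → 2 ≤ p → 1 ≤ q → 1 ≤ m → 1 < i → i ≤ p →
    (HasFiniteOrder (((C p ⊕ C q) ⊕ C m) +M T (1) (p + q) i (p + q + m))
      ⇔ (gcd p q ∣ i ∸ 1 × gcd p m ∣ i ∸ 1))
    × (HasFiniteOrder (((C p ⊕ C q) ⊕ C m) +M T (1) (p + q) i (p + q + m)) →
        IsOrderOf (((C p ⊕ C q) ⊕ C m) +M T (1) (p + q) i (p + q + m)) (lcm (lcm p q) m)
        × Similar (((C p ⊕ C q) ⊕ C m) +M T (1) (p + q) i (p + q + m)) ((C p ⊕ C q) ⊕ C m))
theorem4p9 p q m i 2≤p 1≤q 1≤m 1<i i≤p =
  mk⇔ gcd∣i₁ (λ (gq , gm) → A-finite-order gq gm) ,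
  λ finite → let (gq , gm) = gcd∣i₁ finite in A-order gq gm , A-similar-P gq gm
  where open Theorem p q m i 2≤p 1≤q 1≤m 1<i i≤p
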